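{- Let $r \geq 2$ and $n \geq 1$ be integers, and for a word $w\in\{a,b\}^{rn-1}$ let $[w]$ denote the number of colored permutations $\pi \in G_{r,n}$ whose excedance word $w_\pi$ equals $w$. Then for each $0 \leq k \leq rn-1$, $$[b^ka^{rn-1-k}]= \begin{cases} (k+1)^{n-k}\,k! & 0 \leq k \leq n, \\ n! & n+1 \leq k \leq n(r-1), \\ (nr-k)^{k-nr+n}\,(nr-k)! & n(r-1)+1 \leq k \leq rn-1. \end{cases}$$ Here $b^ka^{rn-1-k}$ denotes the word consisting of $k$ letters $b$ followed by $rn-1-k$ letters $a$.
   Context: Let $\Sigma=\{i^{[j]} : 1\le i\le n,\ 0\le j\le r-1\}$ be the set $[n]$ colored by the colors $0,\dots,r-1$ (so $i^{[0]}=i$, $i^{[1]}=\bar i$, etc.). The group $G_{r,n}=\mathbb{Z}_r\wr S_n$ of colored permutations is identified with the set of bijections $\pi:\Sigma\to\Sigma$ such that whenever $\pi(i^{[\alpha]})=j^{[\beta]}$, also $\pi(i^{[\alpha+1]})=j^{[\beta+1]}$ (color indices taken mod $r$). The color order on $\Sigma$ is the total order $1^{[r-1]}<2^{[r-1]}<\cdots<n^{[r-1]}<1^{[r-2]}<\cdots<n^{[r-2]}<\cdots<1^{[0]}<\cdots<n^{[0]}$. To $\pi\in G_{r,n}$ associate the $r\times n$ matrix $M(\pi)=(t_i^j)$, with rows indexed by $j=r-1,r-2,\dots,0$ (top to bottom) and columns by $i=1,\dots,n$, where $t_i^j=b$ if $\pi(i^{[j]})>i^{[j]}$ in the color order and $t_i^j=a$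 otherwise. The excedance word $w_\pi\in\{a,b\}^{rn-1}$ is obtained by reading the entries of $M(\pi)$ row by row (from the row $j=r-1$ down to the row $j=0$), each row from left to right, and omitting the last entry $t_n^0$. -}

module Defs where

open import Data.Nat using (ℕ; zero; suc; _+_; _*_; _∸_; _<_; _<?_)
open import Data.Nat.DivMod using (_%_; m%n<n)
open import Data.Fin using (Fin; toℕ; fromℕ<) renaming (zero to fzero; suc to fsuc)
open import Data.Fin.Properties using (all?; any?) renaming (_≟_ to _≟F_)
open import Data.Product using (_×_; _,_; ∃; proj₁; proj₂)
open import Data.Product.Properties using () renaming (≡-dec to ×-≡-dec)
open import Data.List using (List; []; _∷_; [_]; map; concatMap; length; filter; reverse; replicate; _++_; cartesianProduct; allFin)
open import Data.List.Properties using () renaming (≡-dec to List-≡-dec)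
open import Relation.Nullary using (Dec; yes; no)
open import Relation.Nullary.Decidable using (_×-dec_; _→-dec_)
open import Relation.Binary.PropositionalEquality using (_≡_; refl)

-- The colored alphabet Σ: the pair (i , j) stands for i^[j]  (i ∈ [n] as Fin n, color j ∈ Fin r).
ColElem : ℕ → ℕ → Set
ColElem n r = Fin n × Fin r

nextColor : ∀ {r} → Fin r → Fin r
nextColor {suc k} j = fromℕ< (m%n<n (suc (toℕ j)) (suc k))

-- Position of i^[j] in the color order
-- 1^[r-1] < ... < n^[r-1] < 1^[r-2] < ... < n^[r-2] < ... < 1^[0] < ... < n^[0].
colorKey : ∀ {n r} → ColElem n r → ℕ
colorKey {n} {r} (i , j) = (r ∸ 1 ∸ toℕ j) * n + toℕ i

_<ᶜ_ : ∀ {n r} → ColElem n r → ColElem n r → Set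
x <ᶜ y = colorKey x < colorKey y

-- Maps Σ → Σ (curried): π i j = π(i^[j]).
ColMap : ℕ → ℕ → Set
ColMap n r = Fin n → Fin r → ColElem n r

IsBijective : ∀ {n r} → ColMap n r → Set
IsBijective {n} {r} π =
  (∀ i j i' j' → π i j ≡ π i' j' → (i , j) ≡ (i' , j'))
  × (∀ (i' : Fin n) (j' : Fin r) → ∃ λ i → ∃ λ j → π i j ≡ (i' , j'))

IsColorCompatible : ∀ {n r} → ColMap n r → Set
IsColorCompatible π = ∀ i α → π i (nextColor α) ≡ (proj₁ (π i α) , nextColor (proj₂ (π i α)))

IsColoredPerm : ∀ {n r} → ColMap n r → Set
IsColoredPerm π = IsBijective π × IsColorCompatible π

data AB : Set where
  a b : AB

_≟AB_ : (x y : AB) → Dec (x ≡ y)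
a ≟AB a = yes refl
a ≟AB b = no (λ ())
b ≟AB a = no (λ ())
b ≟AB b = yes refl

entry : ∀ {n r} → ColMap n r → Fin n → Fin r → AB
entry π i j with colorKey (i , j) <? colorKey (π i j)
... | yes _ = b
... | no _ = a

dropLast : {A : Set} → List A → List A
dropLast [] = []
dropLast (x ∷ []) = []
dropLast (x ∷ y ∷ xs) = x ∷ dropLast (y ∷ xs)

excWord : ∀ {n r} → ColMap n r → List AB
excWord {n} {r} π =
  dropLast (concatMap (λ j → map (λ i → entry π i j) (allFin n)) (reverse (allFin r)))

consF : ∀ {m} {A : Set} → A → (Fin m → A) → Fin (suc m) → A
consF x f fzero = x
consF x f (fsuc i) = f i

allFuns : ∀ {A : Set} (m : ℕ) → List A → List (Fin m → A)
allFuns zero xs = [ (λ ()) ]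
allFuns (suc m) xs = concatMap (λ x → map (consF x) (allFuns m xs)) xs

allColElems : (n r : ℕ) → List (ColElem n r)
allColElems n r = cartesianProduct (allFin n) (allFin r)

allColMaps : (n r : ℕ) → List (ColMap n r)
allColMaps n r = allFuns n (allFuns r (allColElems n r))

_≟Σ_ : ∀ {n r} → (x y : ColElem n r) → Dec (x ≡ y)
_≟Σ_ = ×-≡-dec _≟F_ _≟F_

isBijective? : ∀ {n r} (π : ColMap n r) → Dec (IsBijective π)
isBijective? π =
  all? (λ i → all? (λ j → all? (λ i' → all? (λ j' →
    (π i j ≟Σ π i' j') →-dec ((i , j) ≟Σ (i' , j'))))))
  ×-dec all? (λ i' → all? (λ j' → any? (λ i → any? (λ j → π i j ≟Σ (i' , j')))))

isColorCompatible? : ∀ {n r} (π : ColMap n r) → Dec (IsColorCompatible π)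
isColorCompatible? π =
  all? (λ i → all? (λ α → π i (nextColor α) ≟Σ (proj₁ (π i α) , nextColor (proj₂ (π i α)))))

HasWord : ∀ {n r} → List AB → ColMap n r → Set
HasWord w π = IsColoredPerm π × excWord π ≡ w

hasWord? : ∀ {n r} (w : List AB) (π : ColMap n r) → Dec (HasWord w π)
hasWord? w π = (isBijective? π ×-dec isColorCompatible? π) ×-dec List-≡-dec _≟AB_ (excWord π) w

countWord : (r n : ℕ) → List AB → ℕ
countWord r n w = length (filter (hasWord? {n} {r} w) (allColMaps n r))

bkWord : (r n k : ℕ) → List AB
bkWord r n k = replicate k b ++ replicate (r * n ∸ 1 ∸ k) a

module Submission where

-- Write N = n, R = r and k = q N + s with s < N.  A color-compatible bijection π is
-- determined by the permutation σ(i) = |π(i^[0])| and shifts c_i with π(i^[j]) = σ(i)^[c_i + j]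
-- (module Colors).  Reading M(π) in the color order (Word), w_π = b^k a^(rN−1−k) says that
-- column i has excedances exactly in its top e_i = q + [i < s] rows; comparing positions
-- lexicographically (Lex, Column) this forces c_i ≡ e_i (mod R) and constrains σ(i) only
-- when e_i = 0 (then σ(i) ≤ i) or e_i = R (then σ(i) > i).  So [w] counts rook placements σ
-- on a board of allowed cells (Reduction, by bijective counting with the Listings of all maps).
-- Boards with nested allowed sets are counted by a product formula (Placements); relabelling
-- the rows (a rotation for k < N, a partial reversal for k > N(r−1)) turns the three regimes
-- into staircase boards (Boards), and the theorem is the resulting arithmetic.

open import Defs
open import Data.Nat using (ℕ; suc; _+_; _*_; _∸_; _^_; _<_; _≤_; _!)
open import Data.Product using (_×_)
open import Relation.Binary.PropositionalEquality using (_≡_)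

module Counting where
  open import Data.Nat using (ℕ; zero; suc; _+_; _*_)
  open import Data.Nat.Properties using (+-assoc; *-comm; *-distribˡ-+; *-zeroʳ; +-commutativeSemigroup)
  open import Algebra.Properties.CommutativeSemigroup +-commutativeSemigroup using () renaming (interchange to +-interchange)
  open import Data.List using (List; []; _∷_; map; concatMap; length; filter; _++_)
  open import Data.Product using (_×_; _,_; proj₁; proj₂)
  open import Relation.Nullary using (Dec; yes; no; ¬_)
  open import Relation.Unary using (Decidable)
  open import Relation.Binary.PropositionalEquality using (_≡_; refl; sym; trans; cong; cong₂; module ≡-Reasoning)
  open import Data.Empty using (⊥-elim)
  open import Function using (_∘_)

  indicator : {P : Set} → Dec P → ℕ
  indicator (yes _) = 1
  indicator (no _) = 0

  sumOver : {A : Set} → (A → ℕ) → List A → ℕ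
  sumOver f [] = 0
  sumOver f (x ∷ xs) = f x + sumOver f xs

  count : {A : Set} {P : A → Set} → Decidable P → List A → ℕ
  count P? = sumOver (indicator ∘ P?)

  length-filter≡count : {A : Set} {P : A → Set} (P? : Decidable P) (xs : List A) →
    length (filter P? xs) ≡ count P? xs
  length-filter≡count P? [] = refl
  length-filter≡count P? (x ∷ xs) with P? x
  ... | yes _ = cong suc (length-filter≡count P? xs)
  ... | no _ = length-filter≡count P? xs

  sum-cong : {A : Set} {f g : A → ℕ} (xs : List A) → (∀ x → f x ≡ g x) → sumOver f xs ≡ sumOver g xs
  sum-cong [] _ = refl
  sum-cong (x ∷ xs) f≗g = cong₂ _+_ (f≗g x) (sum-cong xs f≗g)

  sum-zero : {A : Set} (xs : List A) → sumOver (λ _ → 0) xs ≡ 0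
  sum-zero [] = refl
  sum-zero (_ ∷ xs) = sum-zero xs

  sum-++ : {A : Set} (f : A → ℕ) (xs ys : List A) → sumOver f (xs ++ ys) ≡ sumOver f xs + sumOver f ys
  sum-++ f [] ys = refl
  sum-++ f (x ∷ xs) ys = trans (cong (f x +_) (sum-++ f xs ys)) (sym (+-assoc (f x) _ _))

  sum-map : {A B : Set} (f : B → ℕ) (g : A → B) (xs : List A) → sumOver f (map g xs) ≡ sumOver (f ∘ g) xs
  sum-map f g [] = refl
  sum-map f g (x ∷ xs) = cong (f (g x) +_) (sum-map f g xs)

  sum-scale : {A : Set} (c : ℕ) (f : A → ℕ) (xs : List A) → sumOver (λ x → c * f x) xs ≡ c * sumOver f xs
  sum-scale c f [] = sym (*-zeroʳ c)
  sum-scale c f (x ∷ xs) = trans (cong (c * f x +_) (sum-scale c f xs)) (sym (*-distribˡ-+ c (f x) _))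

  sum-+ : {A : Set} (f g : A → ℕ) (xs : List A) → sumOver (λ x → f x + g x) xs ≡ sumOver f xs + sumOver g xs
  sum-+ f g [] = refl
  sum-+ f g (x ∷ xs) = trans (cong ((f x + g x) +_) (sum-+ f g xs)) (+-interchange (f x) (g x) _ _)

  sum-swap : {A B : Set} (h : A → B → ℕ) (xs : List A) (ys : List B) →
    sumOver (λ x → sumOver (h x) ys) xs ≡ sumOver (λ y → sumOver (λ x → h x y) xs) ys
  sum-swap h [] ys = sym (sum-zero ys)
  sum-swap h (x ∷ xs) ys = trans (cong (sumOver (h x) ys +_) (sum-swap h xs ys))
    (sym (sum-+ (h x) (λ y → sumOver (λ x' → h x' y) xs) ys))

  sum-concatMap : {A B C : Set} (F : A → B → C) (h : C → ℕ) (xs : List A) (ys : List B) →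
    sumOver h (concatMap (λ x → map (F x) ys) xs) ≡ sumOver (λ x → sumOver (h ∘ F x) ys) xs
  sum-concatMap F h [] ys = refl
  sum-concatMap F h (x ∷ xs) ys = begin
    sumOver h (map (F x) ys ++ rest)                ≡⟨ sum-++ h (map (F x) ys) rest ⟩
    sumOver h (map (F x) ys) + sumOver h rest        ≡⟨ cong₂ _+_ (sum-map h (F x) ys) (sum-concatMap F h xs ys) ⟩
    sumOver (h ∘ F x) ys + sumOver (λ x → sumOver (h ∘ F x) ys) xs ∎
    where
    open ≡-Reasoning
    rest = concatMap (λ x → map (F x) ys) xs

  sum-product : {A B C : Set} (F : A → B → C) (h : C → ℕ) (u : A → ℕ) (v : B → ℕ) (xs : List A) (ys : List B) →
    (∀ x y → h (F x y) ≡ u x * v y) →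
    sumOver h (concatMap (λ x → map (F x) ys) xs) ≡ sumOver u xs * sumOver v ys
  sum-product F h u v xs ys factor = begin
    sumOver h (concatMap (λ x → map (F x) ys) xs)    ≡⟨ sum-concatMap F h xs ys ⟩
    sumOver (λ x → sumOver (h ∘ F x) ys) xs          ≡⟨ sum-cong xs (λ x → sum-cong ys (factor x)) ⟩
    sumOver (λ x → sumOver (λ y → u x * v y) ys) xs  ≡⟨ sum-cong xs (λ x → sum-scale (u x) v ys) ⟩
    sumOver (λ x → u x * sumOver v ys) xs            ≡⟨ sum-cong xs (λ x → *-comm (u x) _) ⟩
    sumOver (λ x → sumOver v ys * u x) xs            ≡⟨ sum-scale (sumOver v ys) u xs ⟩
    sumOver v ys * sumOver u xs                      ≡⟨ *-comm (sumOver v ys) _ ⟩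
    sumOver u xs * sumOver v ys                      ∎
    where open ≡-Reasoning

  indicator-⇔ : {P Q : Set} (p : Dec P) (q : Dec Q) → (P → Q) → (Q → P) → indicator p ≡ indicator q
  indicator-⇔ (yes _) (yes _) _ _ = refl
  indicator-⇔ (yes x) (no ¬y) to _ = ⊥-elim (¬y (to x))
  indicator-⇔ (no ¬x) (yes y) _ from = ⊥-elim (¬x (from y))
  indicator-⇔ (no _) (no _) _ _ = refl

  indicator-× : {P Q R : Set} (r : Dec R) (p : Dec P) (q : Dec Q) →
    (R → P × Q) → (P × Q → R) → indicator r ≡ indicator p * indicator q
  indicator-× r (yes x) (yes y) to from = indicator-⇔ r (yes (x , y)) to from
  indicator-× r (yes x) (no ¬y) to from = indicator-⇔ r (no ¬y) (proj₂ ∘ to) (λ y → ⊥-elim (¬y y))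
  indicator-× r (no ¬x) q to from = indicator-⇔ r (no ¬x) (proj₁ ∘ to) (λ x → ⊥-elim (¬x x))

  count-⇔ : {A : Set} {P Q : A → Set} (P? : Decidable P) (Q? : Decidable Q) (xs : List A) →
    (∀ x → P x → Q x) → (∀ x → Q x → P x) → count P? xs ≡ count Q? xs
  count-⇔ P? Q? xs to from = sum-cong xs (λ x → indicator-⇔ (P? x) (Q? x) (to x) (from x))

  count-none : {A : Set} {P : A → Set} (P? : Decidable P) (xs : List A) → (∀ x → ¬ P x) → count P? xs ≡ 0
  count-none P? [] _ = refl
  count-none P? (x ∷ xs) ¬P with P? x
  ... | yes p = ⊥-elim (¬P x p)
  ... | no _ = count-none P? xs ¬P

  count-all : {A : Set} {P : A → Set} (P? : Decidable P) (xs : List A) → (∀ x → P x) → count P? xs ≡ length xs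
  count-all P? [] _ = refl
  count-all P? (x ∷ xs) P-all with P? x
  ... | yes _ = cong suc (count-all P? xs P-all)
  ... | no ¬p = ⊥-elim (¬p (P-all x))

module Listings where
  open import Data.Nat using (ℕ; zero; suc; _+_; _*_; _∸_; _≤_; _<_; _≤?_; s≤s; z≤n)
  open import Data.Nat.Properties using (*-identityʳ; ≤-pred)
  open import Data.List using (List; []; _∷_; _++_; map; concatMap; allFin; cartesianProduct)
  open import Data.List.Properties using (map-tabulate; length-tabulate)
  open import Data.Fin using (Fin; toℕ) renaming (zero to fzero; suc to fsuc)
  open import Data.Fin.Properties using (all?; suc-injective) renaming (_≟_ to _≟F_)
  open import Data.Product using (_×_; _,_)
  open import Relation.Nullary using (Dec; yes; no)
  open import Relation.Nullary.Decidable using (_×-dec_)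
  open import Relation.Unary using (Decidable)
  open import Relation.Binary.PropositionalEquality using (_≡_; refl; sym; trans; cong; cong₂; module ≡-Reasoning)
  open import Data.Empty using (⊥-elim)
  open import Function using (_∘_)
  open import Defs using (consF; allFuns; ColElem; allColElems; _≟Σ_; ColMap)
  open Counting

  -- A listing of A: a list meeting every class of a decidable equivalence exactly once.
  -- (Functions are only compared pointwise, so function spaces need '≈' rather than '≡'.)
  record Listing (A : Set) : Set₁ where
    field
      _≈_ : A → A → Set
      _≈?_ : (x y : A) → Dec (x ≈ y)
      elements : List A
      once : ∀ y → count (_≈? y) elements ≡ 1

  open Listing

  weighted-once : {A : Set} (L : Listing A) (c : ℕ) (y : A) →
    sumOver (λ x → c * indicator (_≈?_ L x y)) (elements L) ≡ c
  weighted-once L c y =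
    trans (sum-scale c _ (elements L)) (trans (cong (c *_) (once L y)) (*-identityʳ c))

  -- Both sides equal the double sum of [P x] [y ≈ f x] = [Q y] [x ≈ g y].
  count-bijection : {A B : Set} (LA : Listing A) (LB : Listing B)
    {P : A → Set} (P? : Decidable P) {Q : B → Set} (Q? : Decidable Q) (f : A → B) (g : B → A) →
    (∀ x y → P x → _≈_ LB y (f x) → Q y × _≈_ LA x (g y)) →
    (∀ x y → Q y → _≈_ LA x (g y) → P x × _≈_ LB y (f x)) →
    count P? (elements LA) ≡ count Q? (elements LB)
  count-bijection LA LB P? Q? f g forth back = begin
    sumOver (λ x → indicator (P? x)) xs
      ≡⟨ sum-cong xs (λ x → sym (weighted-once LB (indicator (P? x)) (f x))) ⟩
    sumOver (λ x → sumOver (λ y → indicator (P? x) * indicator (_≈?_ LB y (f x))) ys) xs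
      ≡⟨ sum-cong xs (λ x → sum-cong ys (λ y → pair-swap x y)) ⟩
    sumOver (λ x → sumOver (λ y → indicator (Q? y) * indicator (_≈?_ LA x (g y))) ys) xs
      ≡⟨ sum-swap (λ x y → indicator (Q? y) * indicator (_≈?_ LA x (g y))) xs ys ⟩
    sumOver (λ y → sumOver (λ x → indicator (Q? y) * indicator (_≈?_ LA x (g y))) xs) ys
      ≡⟨ sum-cong ys (λ y → weighted-once LA (indicator (Q? y)) (g y)) ⟩
    sumOver (λ y → indicator (Q? y)) ys ∎
    where
    open ≡-Reasoning
    xs = elements LA
    ys = elements LB
    pair-swap : ∀ x y → indicator (P? x) * indicator (_≈?_ LB y (f x)) ≡ indicator (Q? y) * indicator (_≈?_ LA x (g y))
    pair-swap x y = trans (sym (indicator-× (P? x ×-dec _≈?_ LB y (f x)) (P? x) (_≈?_ LB y (f x)) (λ z → z) (λ z → z)))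
      (indicator-× (P? x ×-dec _≈?_ LB y (f x)) (Q? y) (_≈?_ LA x (g y))
        (λ (p , e) → forth x y p e) (λ (q , e) → back x y q e))

  allFin-suc : ∀ n → allFin (suc n) ≡ fzero ∷ map fsuc (allFin n)
  allFin-suc n = cong (fzero ∷_) (sym (map-tabulate (λ i → i) fsuc))

  count-allFin-suc : ∀ n {P : Fin (suc n) → Set} (P? : Decidable P) →
    count P? (allFin (suc n)) ≡ indicator (P? fzero) + count (P? ∘ fsuc) (allFin n)
  count-allFin-suc n P? =
    trans (cong (count P?) (allFin-suc n)) (cong (indicator (P? fzero) +_) (sum-map _ fsuc (allFin n)))

  allFin-once : ∀ n (y : Fin n) → count (_≟F y) (allFin n) ≡ 1
  allFin-once (suc n) fzero =
    trans (count-allFin-suc n (_≟F fzero)) (cong suc (count-none (λ x → fsuc x ≟F fzero) (allFin n) (λ x ())))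
  allFin-once (suc n) (fsuc y) =
    trans (count-allFin-suc n (_≟F fsuc y))
    (trans (count-⇔ _ (_≟F y) (allFin n) (λ x → suc-injective) (λ x → cong fsuc)) (allFin-once n y))

  finListing : ∀ n → Listing (Fin n)
  finListing n = record { _≈_ = _≡_ ; _≈?_ = _≟F_ ; elements = allFin n ; once = allFin-once n }

  functionListing : {A : Set} (m : ℕ) → Listing A → Listing (Fin m → A)
  functionListing {A} m L = record { _≈_ = _≈ᶠ_ ; _≈?_ = _≈ᶠ?_ ; elements = allFuns m (elements L) ; once = onceᶠ m }
    where
    _≈ᶠ_ : ∀ {m} → (Fin m → A) → (Fin m → A) → Set
    f ≈ᶠ g = ∀ i → _≈_ L (f i) (g i)
    _≈ᶠ?_ : ∀ {m} (f g : Fin m → A) → Dec (f ≈ᶠ g)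
    f ≈ᶠ? g = all? (λ i → _≈?_ L (f i) (g i))
    -- allFuns (suc m) is the product of the choices of f 0 and of f ∘ suc.
    onceᶠ : ∀ m (y : Fin m → A) → count (_≈ᶠ? y) (allFuns m (elements L)) ≡ 1
    onceᶠ zero y with (λ ()) ≈ᶠ? y
    ... | yes _ = refl
    ... | no ¬p = ⊥-elim (¬p (λ ()))
    onceᶠ (suc m) y =
      trans (sum-product consF (indicator ∘ (_≈ᶠ? y)) (indicator ∘ (λ x → _≈?_ L x (y fzero)))
               (indicator ∘ (_≈ᶠ? (y ∘ fsuc))) (elements L) (allFuns m (elements L)) split)
            (cong₂ _*_ (once L (y fzero)) (onceᶠ m (y ∘ fsuc)))
      where
      split : ∀ x h → indicator (consF x h ≈ᶠ? y) ≡ indicator (_≈?_ L x (y fzero)) * indicator (h ≈ᶠ? (y ∘ fsuc))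
      split x h = indicator-× (consF x h ≈ᶠ? y) (_≈?_ L x (y fzero)) (h ≈ᶠ? (y ∘ fsuc))
        (λ e → e fzero , (e ∘ fsuc)) (λ { (e , _) fzero → e ; (_ , e) (fsuc i) → e i })

  cartesianProduct-concatMap : {A B : Set} (xs : List A) (ys : List B) →
    cartesianProduct xs ys ≡ concatMap (λ x → map (x ,_) ys) xs
  cartesianProduct-concatMap [] ys = refl
  cartesianProduct-concatMap (x ∷ xs) ys = cong (map (x ,_) ys ++_) (cartesianProduct-concatMap xs ys)

  colElemListing : ∀ n r → Listing (ColElem n r)
  colElemListing n r = record { _≈_ = _≡_ ; _≈?_ = _≟Σ_ ; elements = allColElems n r ; once = onceΣ }
    where
    onceΣ : ∀ y → count (_≟Σ y) (allColElems n r) ≡ 1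
    onceΣ (y₁ , y₂) =
      trans (cong (count (_≟Σ (y₁ , y₂))) (cartesianProduct-concatMap (allFin n) (allFin r)))
      (trans (sum-product _,_ (indicator ∘ (_≟Σ (y₁ , y₂))) (indicator ∘ (_≟F y₁)) (indicator ∘ (_≟F y₂))
                (allFin n) (allFin r)
                (λ i j → indicator-× ((i , j) ≟Σ (y₁ , y₂)) (i ≟F y₁) (j ≟F y₂)
                           (λ { refl → refl , refl }) (λ { (refl , refl) → refl })))
             (cong₂ _*_ (allFin-once n y₁) (allFin-once r y₂)))

  colMapListing : ∀ n r → Listing (ColMap n r)
  colMapListing n r = functionListing n (functionListing r (colElemListing n r))

  endoListing : ∀ n → Listing (Fin n → Fin n)
  endoListing n = functionListing n (finListing n)

  count-everything : ∀ N {P : Fin N → Set} (P? : Decidable P) → (∀ t → P t) → count P? (allFin N) ≡ N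
  count-everything N P? P-all = trans (count-all P? (allFin N) P-all) (length-tabulate (λ i → i))

  count-atMost : ∀ N c → c < N → count (λ (t : Fin N) → toℕ t ≤? c) (allFin N) ≡ suc c
  count-atMost (suc N) zero _ =
    trans (count-allFin-suc N (λ t → toℕ t ≤? zero))
    (cong suc (count-none (λ t → suc (toℕ t) ≤? zero) (allFin N) (λ x ())))
  count-atMost (suc N) (suc c) (s≤s c<N) =
    trans (count-allFin-suc N (λ t → toℕ t ≤? suc c))
    (cong suc (trans (count-⇔ (λ t → suc (toℕ t) ≤? suc c) (λ t → toℕ t ≤? c) (allFin N) (λ x → ≤-pred) (λ x → s≤s))
                     (count-atMost N c c<N)))

  count-atLeast : ∀ N d → d ≤ N → count (λ (t : Fin N) → d ≤? toℕ t) (allFin N) ≡ N ∸ d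
  count-atLeast N zero _ = count-everything N (λ t → zero ≤? toℕ t) (λ t → z≤n)
  count-atLeast (suc N) (suc d) (s≤s d≤N) =
    trans (count-allFin-suc N (λ t → suc d ≤? toℕ t))
    (trans (count-⇔ (λ t → suc d ≤? suc (toℕ t)) (λ t → d ≤? toℕ t) (allFin N) (λ x → ≤-pred) (λ x → s≤s))
           (count-atLeast N d d≤N))

module Placements where
  open import Data.Nat using (ℕ; zero; suc; _+_; _*_; _∸_; _^_; _!; _<_; s≤s; z≤n)
  open import Data.Nat.Properties using (*-identityʳ; *-zeroʳ; *-comm; *-assoc; +-identityʳ; m+n∸n≡m; ∸-+-assoc; <-irrefl)
  open import Data.List using (allFin)
  open import Data.Fin using (Fin; toℕ; punchOut) renaming (zero to fzero; suc to fsuc)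
  open import Data.Fin.Properties using (all?; any?; suc-injective; 0≢1+n; punchOut-injective; injective⇒≤) renaming (_≟_ to _≟F_)
  open import Data.Product using (_×_; _,_; proj₁; proj₂; ∃)
  open import Relation.Nullary using (Dec; yes; no)
  open import Relation.Nullary.Decidable using (_×-dec_; _→-dec_; ¬?)
  open import Relation.Binary.PropositionalEquality using (_≡_; _≢_; refl; sym; trans; cong; cong₂; subst; module ≡-Reasoning)
  open import Data.Empty using (⊥-elim)
  open import Function using (_∘_)
  open import Defs using (consF; allFuns)
  open Counting
  open Listings

  prodBelow : ℕ → (ℕ → ℕ) → ℕ
  prodBelow zero f = 1
  prodBelow (suc m) f = f 0 * prodBelow m (f ∘ suc)

  prodBelow-cong : ∀ m {f g : ℕ → ℕ} → (∀ i → i < m → f i ≡ g i) → prodBelow m f ≡ prodBelow m g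
  prodBelow-cong zero _ = refl
  prodBelow-cong (suc m) f≗g = cong₂ _*_ (f≗g 0 (s≤s z≤n)) (prodBelow-cong m (λ i i<m → f≗g (suc i) (s≤s i<m)))

  prodBelow-split : ∀ x y (f : ℕ → ℕ) → prodBelow (x + y) f ≡ prodBelow x f * prodBelow y (λ i → f (x + i))
  prodBelow-split zero y f = sym (+-identityʳ _)
  prodBelow-split (suc x) y f = trans (cong (f 0 *_) (prodBelow-split x y (f ∘ suc))) (sym (*-assoc (f 0) _ _))

  prodBelow-const : ∀ x c → prodBelow x (λ _ → c) ≡ c ^ x
  prodBelow-const zero c = refl
  prodBelow-const (suc x) c = cong (c *_) (prodBelow-const x c)

  prodBelow-factorial : ∀ y → prodBelow y (λ i → y ∸ i) ≡ y !
  prodBelow-factorial zero = refl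
  prodBelow-factorial (suc y) = cong (suc y *_) (prodBelow-factorial y)

  IsInjective : ∀ {m N} → (Fin m → Fin N) → Set
  IsInjective τ = ∀ i j → τ i ≡ τ j → i ≡ j

  isInjective? : ∀ {m N} (τ : Fin m → Fin N) → Dec (IsInjective τ)
  isInjective? τ = all? λ i → all? λ j → (τ i ≟F τ j) →-dec (i ≟F j)

  -- An injective endomap of Fin m is onto (pigeonhole, via injective⇒≤).
  injective⇒surjective : ∀ {m} (τ : Fin m → Fin m) → IsInjective τ → ∀ t → ∃ λ i → τ i ≡ t
  injective⇒surjective {suc m} τ τ-inj t with any? (λ i → τ i ≟F t)
  ... | yes hit = hit
  ... | no miss = ⊥-elim (<-irrefl refl (injective⇒≤ squeeze-inj))
    where
    -- Missing t, τ would inject Fin (suc m) into Fin m.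
    squeeze : Fin (suc m) → Fin m
    squeeze i = punchOut {i = t} {j = τ i} (λ e → miss (i , sym e))
    squeeze-inj : ∀ {x y} → squeeze x ≡ squeeze y → x ≡ y
    squeeze-inj {x} {y} e = τ-inj x y (punchOut-injective (λ e → miss (x , sym e)) (λ e → miss (y , sym e)) e)

  Placement : ∀ {m N} → (ℕ → Fin N → Set) → (Fin m → Fin N) → Set
  Placement T τ = IsInjective τ × (∀ i → T (toℕ i) (τ i))

  placement? : ∀ {m N} {T : ℕ → Fin N → Set} → (∀ i y → Dec (T i y)) → (τ : Fin m → Fin N) → Dec (Placement T τ)
  placement? T? τ = isInjective? τ ×-dec all? (λ i → T? (toℕ i) (τ i))

  placements : ∀ m N {T : ℕ → Fin N → Set} → (∀ i y → Dec (T i y)) → ℕ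
  placements m N T? = count (placement? {m} T?) (allFuns m (allFin N))

  allowed : ∀ {N} {T : ℕ → Fin N → Set} → (∀ i y → Dec (T i y)) → ℕ → ℕ
  allowed {N} T? i = count (T? i) (allFin N)

  Nested : ∀ {N} → (ℕ → Fin N → Set) → Set
  Nested T = ∀ i y → T i y → T (suc i) y

  -- Once row 0 occupies column x, the remaining rows see the allowed cells minus column x.
  Avoiding : ∀ {N} → (ℕ → Fin N → Set) → Fin N → ℕ → Fin N → Set
  Avoiding T x i y = T (suc i) y × y ≢ x

  avoiding? : ∀ {N} {T : ℕ → Fin N → Set} → (∀ i y → Dec (T i y)) → ∀ x i y → Dec (Avoiding T x i y)
  avoiding? T? x i y = T? (suc i) y ×-dec ¬? (y ≟F x)

  count-without : ∀ {N} {P : Fin N → Set} (P? : ∀ y → Dec (P y)) x → P x →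
    count (λ y → P? y ×-dec ¬? (y ≟F x)) (allFin N) + 1 ≡ count P? (allFin N)
  count-without {N} P? x Px = begin
    count P∖x? (allFin N) + 1
      ≡⟨ cong (count P∖x? (allFin N) +_) (sym (allFin-once N x)) ⟩
    count P∖x? (allFin N) + count (_≟F x) (allFin N)
      ≡⟨ sym (sum-+ (indicator ∘ P∖x?) (indicator ∘ (_≟F x)) (allFin N)) ⟩
    sumOver (λ y → indicator (P∖x? y) + indicator (y ≟F x)) (allFin N)
      ≡⟨ sum-cong (allFin N) split ⟩
    count P? (allFin N) ∎
    where
    open ≡-Reasoning
    P∖x? = λ y → P? y ×-dec ¬? (y ≟F x)
    split : ∀ y → indicator (P? y ×-dec ¬? (y ≟F x)) + indicator (y ≟F x) ≡ indicator (P? y)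
    split y with y ≟F x
    ... | yes refl = trans (cong (_+ 1) (indicator-⇔ (P? y ×-dec ¬? (yes refl)) (no (λ z → z)) (λ z → proj₂ z refl) λ ()))
                           (indicator-⇔ (yes Px) (P? y) (λ z → z) (λ _ → Px))
    ... | no y≢x = trans (+-identityʳ _) (indicator-⇔ (P? y ×-dec ¬? (no y≢x)) (P? y) proj₁ (λ p → p , y≢x))

  placement-cons⇒ : ∀ {m N} {T : ℕ → Fin N → Set} x (h : Fin m → Fin N) →
    Placement T (consF x h) → Placement (Avoiding T x) h
  placement-cons⇒ x h (inj , allowedᶜ) =
    (λ i j e → suc-injective (inj (fsuc i) (fsuc j) e)) ,
    (λ i → allowedᶜ (fsuc i) , (λ e → 0≢1+n (inj fzero (fsuc i) (sym e))))

  placement-cons⇐ : ∀ {m N} {T : ℕ → Fin N → Set} x (h : Fin m → Fin N) → T 0 x →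
    Placement (Avoiding T x) h → Placement T (consF x h)
  placement-cons⇐ {T = T} x h Tx (inj , allowedʰ) = inj′ , allowed′
    where
    inj′ : IsInjective (consF x h)
    inj′ fzero fzero _ = refl
    inj′ fzero (fsuc j) e = ⊥-elim (proj₂ (allowedʰ j) (sym e))
    inj′ (fsuc i) fzero e = ⊥-elim (proj₂ (allowedʰ i) e)
    inj′ (fsuc i) (fsuc j) e = cong fsuc (inj i j e)
    allowed′ : ∀ i → T (toℕ i) (consF x h i)
    allowed′ fzero = Tx
    allowed′ (fsuc i) = proj₁ (allowedʰ i)

  -- In a nested board a column allowed in row 0 stays allowed in every later row, so
  -- avoiding it removes exactly one choice from each later row.
  nested-always : ∀ {N} {T : ℕ → Fin N → Set} → Nested T → ∀ {x} → T 0 x → ∀ i → T (suc i) x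
  nested-always nested Tx zero = nested 0 _ Tx
  nested-always nested Tx (suc i) = nested (suc i) _ (nested-always nested Tx i)

  choices-avoiding : ∀ {N} {T : ℕ → Fin N → Set} (T? : ∀ i y → Dec (T i y)) → Nested T → ∀ {x} → T 0 x →
    ∀ i → allowed (avoiding? T? x) i ∸ i ≡ allowed T? (suc i) ∸ suc i
  choices-avoiding T? nested {x} Tx i = begin
    allowed (avoiding? T? x) i ∸ i
      ≡⟨ cong (_∸ i) (sym (m+n∸n≡m _ 1)) ⟩
    allowed (avoiding? T? x) i + 1 ∸ 1 ∸ i
      ≡⟨ cong (λ z → z ∸ 1 ∸ i) (count-without (T? (suc i)) x (nested-always nested Tx i)) ⟩
    allowed T? (suc i) ∸ 1 ∸ i
      ≡⟨ ∸-+-assoc (allowed T? (suc i)) 1 i ⟩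
    allowed T? (suc i) ∸ suc i ∎
    where open ≡-Reasoning

  count-nested : ∀ m N {T : ℕ → Fin N → Set} (T? : ∀ i y → Dec (T i y)) → Nested T →
    placements m N T? ≡ prodBelow m (λ i → allowed T? i ∸ i)
  count-nested zero N T? _ with placement? {zero} T? (λ ())
  ... | yes _ = refl
  ... | no ¬p = ⊥-elim (¬p ((λ ()) , (λ ())))
  count-nested (suc m) N {T} T? nested = begin
    placements (suc m) N T?
      ≡⟨ sum-concatMap consF (indicator ∘ placement? T?) (allFin N) rest ⟩
    sumOver (λ x → count (placement? T? ∘ consF x) rest) (allFin N)
      ≡⟨ sum-cong (allFin N) first-row ⟩
    sumOver (λ x → C * indicator (T? 0 x)) (allFin N)
      ≡⟨ sum-scale C _ (allFin N) ⟩
    C * allowed T? 0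
      ≡⟨ *-comm C _ ⟩
    allowed T? 0 * C ∎
    where
    open ≡-Reasoning
    rest = allFuns m (allFin N)
    C = prodBelow m (λ i → allowed T? (suc i) ∸ suc i)
    first-row : ∀ x → count (placement? T? ∘ consF x) rest ≡ C * indicator (T? 0 x)
    first-row x = by-cases (T? 0 x)
      where
      by-cases : (d : Dec (T 0 x)) → count (placement? T? ∘ consF x) rest ≡ C * indicator d
      by-cases (no ¬Tx) = trans (count-none (placement? T? ∘ consF x) rest (λ h p → ¬Tx (proj₂ p fzero))) (sym (*-zeroʳ C))
      by-cases (yes Tx) = begin
        count (placement? T? ∘ consF x) rest
          ≡⟨ count-⇔ (placement? T? ∘ consF x) (placement? (avoiding? T? x)) rest
                     (placement-cons⇒ {T = T} x) (λ h → placement-cons⇐ {T = T} x h Tx) ⟩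
        placements m N (avoiding? T? x)
          ≡⟨ count-nested m N (avoiding? T? x) (λ i y (Ty , y≢x) → nested (suc i) y Ty , y≢x) ⟩
        prodBelow m (λ i → allowed (avoiding? T? x) i ∸ i)
          ≡⟨ prodBelow-cong m (λ i _ → choices-avoiding T? nested Tx i) ⟩
        C
          ≡⟨ sym (*-identityʳ C) ⟩
        C * 1 ∎

  placement-resp : ∀ {m N} {T : ℕ → Fin N → Set} {τ τ′ : Fin m → Fin N} →
    (∀ i → τ i ≡ τ′ i) → Placement T τ → Placement T τ′
  placement-resp {T = T} τ≗τ′ (inj , ok) =
    (λ i j e → inj i j (trans (τ≗τ′ i) (trans e (sym (τ≗τ′ j))))) ,
    (λ i → subst (T (toℕ i)) (τ≗τ′ i) (ok i))

  placement-relabel : ∀ {m N} {S T : ℕ → Fin N → Set} (ι : Fin m → Fin m) → IsInjective ι →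
    (∀ i t → S (toℕ (ι i)) t → T (toℕ i) t) → ∀ {σ} → Placement S σ → Placement T (σ ∘ ι)
  placement-relabel ι ι-inj S⇒T {σ} (inj , ok) =
    (λ i j e → ι-inj i j (inj (ι i) (ι j) e)) , (λ i → S⇒T i (σ (ι i)) (ok (ι i)))

  placements-relabel : ∀ N {S T : ℕ → Fin N → Set} (S? : ∀ i t → Dec (S i t)) (T? : ∀ i t → Dec (T i t))
    (ι ι⁻¹ : Fin N → Fin N) → (∀ x → ι (ι⁻¹ x) ≡ x) → (∀ x → ι⁻¹ (ι x) ≡ x) →
    (∀ i t → S (toℕ (ι i)) t → T (toℕ i) t) → (∀ i t → T (toℕ i) t → S (toℕ (ι i)) t) →
    placements N N S? ≡ placements N N T?
  placements-relabel N {S} {T} S? T? ι ι⁻¹ ιι⁻¹ ι⁻¹ι S⇒T T⇒S =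
    count-bijection (endoListing N) (endoListing N) (placement? S?) (placement? T?) (_∘ ι) (_∘ ι⁻¹) forth back
    where
    inverse-injective : ∀ {f g : Fin N → Fin N} → (∀ x → g (f x) ≡ x) → IsInjective f
    inverse-injective {f} {g} gf i j e = trans (sym (gf i)) (trans (cong g e) (gf j))
    T⇒S′ : ∀ x t → T (toℕ (ι⁻¹ x)) t → S (toℕ x) t
    T⇒S′ x t Tt = subst (λ z → S (toℕ z) t) (ιι⁻¹ x) (T⇒S (ι⁻¹ x) t Tt)
    forth : ∀ σ τ → Placement S σ → (∀ i → τ i ≡ σ (ι i)) → Placement T τ × (∀ x → σ x ≡ τ (ι⁻¹ x))
    forth σ τ pl τ≗σι =
      placement-resp {T = T} (λ i → sym (τ≗σι i))
        (placement-relabel {S = S} {T = T} ι (inverse-injective {g = ι⁻¹} ι⁻¹ι) S⇒T pl) ,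
      (λ x → sym (trans (τ≗σι (ι⁻¹ x)) (cong σ (ιι⁻¹ x))))
    back : ∀ σ τ → Placement T τ → (∀ x → σ x ≡ τ (ι⁻¹ x)) → Placement S σ × (∀ i → τ i ≡ σ (ι i))
    back σ τ pl σ≗τι⁻¹ =
      placement-resp {T = S} (λ x → sym (σ≗τι⁻¹ x))
        (placement-relabel {S = T} {T = S} ι⁻¹ (inverse-injective {g = ι} ιι⁻¹) T⇒S′ pl) ,
      (λ i → sym (trans (σ≗τι⁻¹ (ι i)) (cong τ (ι⁻¹ι i))))

  staircase-count : ∀ N m l c {T : ℕ → Fin N → Set} (T? : ∀ i y → Dec (T i y)) → m + l ≡ N → Nested T →
    (∀ i → i < m → allowed T? i ∸ i ≡ c) → (∀ j → j < l → allowed T? (m + j) ∸ (m + j) ≡ l ∸ j) →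
    placements N N T? ≡ c ^ m * l !
  staircase-count N m l c T? m+l≡N nested first last = begin
    placements N N T?                                               ≡⟨ count-nested N N T? nested ⟩
    prodBelow N choices                                             ≡⟨ cong (λ z → prodBelow z choices) (sym m+l≡N) ⟩
    prodBelow (m + l) choices                                       ≡⟨ prodBelow-split m l choices ⟩
    prodBelow m choices * prodBelow l (λ j → choices (m + j))       ≡⟨ cong₂ _*_ (prodBelow-cong m first) (prodBelow-cong l last) ⟩
    prodBelow m (λ _ → c) * prodBelow l (λ j → l ∸ j)               ≡⟨ cong₂ _*_ (prodBelow-const m c) (prodBelow-factorial l) ⟩
    c ^ m * l !                                                     ∎
    where
    open ≡-Reasoning
    choices = λ i → allowed T? i ∸ i

module Colors where
  open import Data.Nat using (ℕ; zero; suc; _+_; _∸_; _≤_)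
  open import Data.Nat.Properties using (+-comm; +-assoc; +-suc; +-identityʳ; <⇒≤; m+[n∸m]≡n)
  open import Data.Nat.DivMod using (_%_; m%n<n; %-distribˡ-+; m%n%n≡m%n; m<n⇒m%n≡m; [m+n]%n≡m%n)
  open import Data.Fin using (Fin; toℕ; fromℕ<) renaming (zero to fzero)
  open import Data.Fin.Properties using (toℕ-fromℕ<; toℕ-injective; toℕ<n)
  open import Data.Product using (_,_; proj₁; proj₂)
  open import Relation.Binary.PropositionalEquality using (_≡_; refl; sym; trans; cong; module ≡-Reasoning)
  open import Defs using (ColMap; nextColor; IsColorCompatible)

  module _ {r₁ : ℕ} where
    private
      R = suc r₁

    %-absorbʳ : ∀ u x → (u + x % R) % R ≡ (u + x) % R
    %-absorbʳ u x = begin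
      (u + x % R) % R              ≡⟨ %-distribˡ-+ u (x % R) R ⟩
      (u % R + x % R % R) % R      ≡⟨ cong (λ z → (u % R + z) % R) (m%n%n≡m%n x R) ⟩
      (u % R + x % R) % R          ≡⟨ sym (%-distribˡ-+ u x R) ⟩
      (u + x) % R                  ∎
      where open ≡-Reasoning

    %-absorbˡ : ∀ x u → (x % R + u) % R ≡ (x + u) % R
    %-absorbˡ x u = trans (cong (_% R) (+-comm (x % R) u)) (trans (%-absorbʳ u x) (cong (_% R) (+-comm u x)))

    toℕ-next : ∀ (j : Fin R) → toℕ (nextColor j) ≡ suc (toℕ j) % R
    toℕ-next j = toℕ-fromℕ< _

    fin-%-id : ∀ (j : Fin R) → toℕ j % R ≡ toℕ j
    fin-%-id j = m<n⇒m%n≡m (toℕ<n j)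

    shift : Fin R → Fin R → Fin R
    shift c j = fromℕ< (m%n<n (toℕ c + toℕ j) R)

    unshift : Fin R → Fin R → Fin R
    unshift c y = fromℕ< (m%n<n (toℕ y + (R ∸ toℕ c)) R)

    toℕ-shift : ∀ c j → toℕ (shift c j) ≡ (toℕ c + toℕ j) % R
    toℕ-shift c j = toℕ-fromℕ< _

    shift-next : ∀ c α → shift c (nextColor α) ≡ nextColor (shift c α)
    shift-next c α = toℕ-injective (begin
      toℕ (shift c (nextColor α))         ≡⟨ toℕ-shift c (nextColor α) ⟩
      (toℕ c + toℕ (nextColor α)) % R     ≡⟨ cong (λ z → (toℕ c + z) % R) (toℕ-next α) ⟩
      (toℕ c + suc (toℕ α) % R) % R       ≡⟨ %-absorbʳ (toℕ c) (suc (toℕ α)) ⟩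
      (toℕ c + suc (toℕ α)) % R           ≡⟨ cong (_% R) (+-suc (toℕ c) (toℕ α)) ⟩
      suc (toℕ c + toℕ α) % R             ≡⟨ sym (%-absorbʳ 1 (toℕ c + toℕ α)) ⟩
      suc ((toℕ c + toℕ α) % R) % R       ≡⟨ cong (λ z → suc z % R) (sym (toℕ-shift c α)) ⟩
      suc (toℕ (shift c α)) % R           ≡⟨ sym (toℕ-next (shift c α)) ⟩
      toℕ (nextColor (shift c α))         ∎)
      where open ≡-Reasoning

    cancel-complement : ∀ x z → x ≤ R → x + (z + (R ∸ x)) ≡ z + R
    cancel-complement x z x≤R = begin
      x + (z + (R ∸ x))    ≡⟨ sym (+-assoc x z (R ∸ x)) ⟩
      x + z + (R ∸ x)      ≡⟨ cong (_+ (R ∸ x)) (+-comm x z) ⟩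
      z + x + (R ∸ x)      ≡⟨ +-assoc z x (R ∸ x) ⟩
      z + (x + (R ∸ x))    ≡⟨ cong (z +_) (m+[n∸m]≡n x≤R) ⟩
      z + R                ∎
      where open ≡-Reasoning

    shift-unshift : ∀ c y → shift c (unshift c y) ≡ y
    shift-unshift c y = toℕ-injective (begin
      toℕ (shift c (unshift c y))                   ≡⟨ toℕ-shift c (unshift c y) ⟩
      (toℕ c + toℕ (unshift c y)) % R               ≡⟨ cong (λ z → (toℕ c + z) % R) (toℕ-fromℕ< _) ⟩
      (toℕ c + (toℕ y + (R ∸ toℕ c)) % R) % R       ≡⟨ %-absorbʳ (toℕ c) _ ⟩
      (toℕ c + (toℕ y + (R ∸ toℕ c))) % R           ≡⟨ cong (_% R) (cancel-complement (toℕ c) (toℕ y) (<⇒≤ (toℕ<n c))) ⟩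
      (toℕ y + R) % R                               ≡⟨ [m+n]%n≡m%n (toℕ y) R ⟩
      toℕ y % R                                     ≡⟨ fin-%-id y ⟩
      toℕ y                                         ∎)
      where open ≡-Reasoning

    unshift-shift : ∀ c j → unshift c (shift c j) ≡ j
    unshift-shift c j = toℕ-injective (begin
      toℕ (unshift c (shift c j))                   ≡⟨ toℕ-fromℕ< _ ⟩
      (toℕ (shift c j) + (R ∸ toℕ c)) % R           ≡⟨ cong (λ z → (z + (R ∸ toℕ c)) % R) (toℕ-shift c j) ⟩
      ((toℕ c + toℕ j) % R + (R ∸ toℕ c)) % R       ≡⟨ %-absorbˡ (toℕ c + toℕ j) (R ∸ toℕ c) ⟩
      (toℕ c + toℕ j + (R ∸ toℕ c)) % R             ≡⟨ cong (_% R) (trans (+-assoc (toℕ c) (toℕ j) _)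
                                                          (cancel-complement (toℕ c) (toℕ j) (<⇒≤ (toℕ<n c)))) ⟩
      (toℕ j + R) % R                               ≡⟨ [m+n]%n≡m%n (toℕ j) R ⟩
      toℕ j % R                                     ≡⟨ fin-%-id j ⟩
      toℕ j                                         ∎)
      where open ≡-Reasoning

    shift-injective : ∀ c j j′ → shift c j ≡ shift c j′ → j ≡ j′
    shift-injective c j j′ e = trans (sym (unshift-shift c j)) (trans (cong (unshift c) e) (unshift-shift c j′))

    next^ : ℕ → Fin R → Fin R
    next^ zero c = c
    next^ (suc m) c = nextColor (next^ m c)

    toℕ-next^ : ∀ m c → toℕ (next^ m c) ≡ (toℕ c + m) % R
    toℕ-next^ zero c = trans (sym (fin-%-id c)) (cong (_% R) (sym (+-identityʳ (toℕ c))))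
    toℕ-next^ (suc m) c = begin
      toℕ (nextColor (next^ m c))     ≡⟨ toℕ-next (next^ m c) ⟩
      suc (toℕ (next^ m c)) % R       ≡⟨ cong (λ z → suc z % R) (toℕ-next^ m c) ⟩
      suc ((toℕ c + m) % R) % R       ≡⟨ %-absorbʳ 1 (toℕ c + m) ⟩
      suc (toℕ c + m) % R             ≡⟨ cong (_% R) (sym (+-suc (toℕ c) m)) ⟩
      (toℕ c + suc m) % R             ∎
      where open ≡-Reasoning

    next^-shift : ∀ c j → next^ (toℕ j) c ≡ shift c j
    next^-shift c j = toℕ-injective (trans (toℕ-next^ (toℕ j) c) (sym (toℕ-shift c j)))

    compatible⇒shift : ∀ {n} (π : ColMap n R) → IsColorCompatible π →
      ∀ i j → π i j ≡ (proj₁ (π i fzero) , shift (proj₂ (π i fzero)) j)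
    compatible⇒shift π compatible i j = begin
      π i j                                                ≡⟨ cong (π i) (sym (trans (next^-shift fzero j) zero-shift)) ⟩
      π i (next^ (toℕ j) fzero)                            ≡⟨ iterate (toℕ j) ⟩
      (proj₁ (π i fzero) , next^ (toℕ j) (proj₂ (π i fzero))) ≡⟨ cong (proj₁ (π i fzero) ,_) (next^-shift _ j) ⟩
      (proj₁ (π i fzero) , shift (proj₂ (π i fzero)) j)     ∎
      where
      open ≡-Reasoning
      zero-shift : shift fzero j ≡ j
      zero-shift = toℕ-injective (trans (toℕ-shift fzero j) (fin-%-id j))
      iterate : ∀ m → π i (next^ m fzero) ≡ (proj₁ (π i fzero) , next^ m (proj₂ (π i fzero)))
      iterate zero = refl
      iterate (suc m) = trans (compatible i (next^ m fzero))
        (cong (λ z → (proj₁ z , nextColor (proj₂ z))) (iterate m))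

module Lex where
  open import Data.Nat using (ℕ; suc; _+_; _*_; _∸_; _<_; _≤_; _<?_)
  open import Data.Nat.Properties
    using (*-monoˡ-≤; +-cancelˡ-<; +-cancelˡ-≡; +-cancelˡ-≤; +-comm; +-identityʳ; +-monoʳ-<;
           +-monoʳ-≤; +-suc; <-asym; <-cmp; <-irrefl; m∸[m∸n]≡n; m∸n+n≡m; m≤m+n; m≤n⇒m<n∨m≡n; n≤1+n;
           ∸-cancelʳ-<; ∸-monoʳ-<; ≤-pred; ≤-reflexive; ≤-trans; module ≤-Reasoning)
  open import Data.Product using (_×_; _,_)
  open import Data.Sum using (_⊎_; inj₁; inj₂)
  open import Relation.Nullary using (yes; no; ¬_)
  open import Relation.Binary using (tri<; tri≈; tri>)
  open import Relation.Binary.PropositionalEquality using (_≡_; refl; sym; trans; cong; subst)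
  open import Data.Empty using (⊥-elim)
  open import Function.Bundles using (_⇔_; mk⇔; Equivalence)

  lex-<-row : ∀ {N} ρ ρ′ i t → ρ < ρ′ → i < N → ρ * N + i < ρ′ * N + t
  lex-<-row {N} ρ ρ′ i t ρ<ρ′ i<N = begin-strict
      ρ * N + i    <⟨ +-monoʳ-< (ρ * N) i<N ⟩
      ρ * N + N    ≡⟨ +-comm (ρ * N) N ⟩
      suc ρ * N    ≤⟨ *-monoˡ-≤ N ρ<ρ′ ⟩
      ρ′ * N       ≤⟨ m≤m+n (ρ′ * N) t ⟩
      ρ′ * N + t   ∎
    where open ≤-Reasoning

  lex-< : ∀ {N} ρ ρ′ i t → i < N → t < N → (ρ * N + i < ρ′ * N + t) ⇔ (ρ < ρ′ ⊎ (ρ ≡ ρ′ × i < t))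
  lex-< {N} ρ ρ′ i t i<N t<N = mk⇔ to from
    where
    to : ρ * N + i < ρ′ * N + t → ρ < ρ′ ⊎ (ρ ≡ ρ′ × i < t)
    to h with <-cmp ρ ρ′
    ... | tri< ρ<ρ′ _ _ = inj₁ ρ<ρ′
    ... | tri≈ _ refl _ = inj₂ (refl , +-cancelˡ-< (ρ * N) i t h)
    ... | tri> _ _ ρ′<ρ = ⊥-elim (<-asym h (lex-<-row ρ′ ρ t i ρ′<ρ t<N))
    from : ρ < ρ′ ⊎ (ρ ≡ ρ′ × i < t) → ρ * N + i < ρ′ * N + t
    from (inj₁ ρ<ρ′) = lex-<-row ρ ρ′ i t ρ<ρ′ i<N
    from (inj₂ (refl , i<t)) = +-monoʳ-< (ρ * N) i<t

  lex-≡ : ∀ {N} ρ ρ′ i t → i < N → t < N → ρ * N + i ≡ ρ′ * N + t → ρ ≡ ρ′ × i ≡ t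
  lex-≡ {N} ρ ρ′ i t i<N t<N h with <-cmp ρ ρ′
  ... | tri< ρ<ρ′ _ _ = ⊥-elim (<-irrefl h (lex-<-row ρ ρ′ i t ρ<ρ′ i<N))
  ... | tri> _ _ ρ′<ρ = ⊥-elim (<-irrefl (sym h) (lex-<-row ρ′ ρ t i ρ′<ρ t<N))
  ... | tri≈ _ refl _ = refl , +-cancelˡ-≡ (ρ * N) i t h

  below : ℕ → ℕ → ℕ
  below s i with i <? s
  ... | yes _ = 1
  ... | no _ = 0

  below-yes : ∀ {s i} → i < s → below s i ≡ 1
  below-yes {s} {i} i<s with i <? s
  ... | yes _ = refl
  ... | no i≮s = ⊥-elim (i≮s i<s)

  below-no : ∀ {s i} → ¬ i < s → below s i ≡ 0
  below-no {s} {i} i≮s with i <? s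
  ... | yes i<s = ⊥-elim (i≮s i<s)
  ... | no _ = refl

  lex-<-threshold : ∀ {N} q s ρ i → s < N → i < N → (ρ * N + i < q * N + s) ⇔ (ρ < q + below s i)
  lex-<-threshold {N} q s ρ i s<N i<N = mk⇔ to from
    where
    open Equivalence (lex-< ρ q i s i<N s<N) renaming (to to lex-to; from to lex-from)
    to : ρ * N + i < q * N + s → ρ < q + below s i
    to h with i <? s | lex-to h
    ... | yes _ | inj₁ ρ<q = ≤-trans ρ<q (≤-trans (n≤1+n q) (≤-reflexive (+-comm 1 q)))
    ... | yes _ | inj₂ (refl , _) = ≤-reflexive (+-comm 1 ρ)
    ... | no _ | inj₁ ρ<q = subst (ρ <_) (sym (+-identityʳ q)) ρ<q
    ... | no i≮s | inj₂ (_ , i<s) = ⊥-elim (i≮s i<s)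
    from : ρ < q + below s i → ρ * N + i < q * N + s
    from h with i <? s
    ... | yes i<s with m≤n⇒m<n∨m≡n (≤-pred (subst (suc ρ ≤_) (+-comm q 1) h))
    ...   | inj₁ ρ<q = lex-from (inj₁ ρ<q)
    ...   | inj₂ ρ≡q = lex-from (inj₂ (ρ≡q , i<s))
    from h | no _ = lex-from (inj₁ (subst (ρ <_) (+-identityʳ q) h))

  -- Rows are numbered downwards: row ρ = r₁ ∸ J carries the color J ≤ r₁.
  row-< : ∀ r₁ J e → J ≤ r₁ → (r₁ ∸ J < e) ⇔ (suc r₁ ≤ J + e)
  row-< r₁ J e J≤r₁ = mk⇔
    (λ h → subst (_≤ J + e) J+row≡R (+-monoʳ-≤ J {suc (r₁ ∸ J)} {e} h))
    (λ h → +-cancelˡ-≤ J (suc (r₁ ∸ J)) e (subst (_≤ J + e) (sym J+row≡R) h))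
    where
    J+row≡R : J + suc (r₁ ∸ J) ≡ suc r₁
    J+row≡R = trans (+-suc J (r₁ ∸ J)) (cong suc (trans (+-comm J (r₁ ∸ J)) (m∸n+n≡m J≤r₁)))

  row-<-flip : ∀ r₁ J J′ → J ≤ r₁ → (r₁ ∸ J < r₁ ∸ J′) ⇔ (J′ < J)
  row-<-flip r₁ J J′ J≤r₁ = mk⇔ ∸-cancelʳ-< (λ J′<J → ∸-monoʳ-< J′<J J≤r₁)

  row-≡ : ∀ r₁ J J′ → J ≤ r₁ → J′ ≤ r₁ → r₁ ∸ J ≡ r₁ ∸ J′ → J ≡ J′
  row-≡ r₁ J J′ J≤r₁ J′≤r₁ h = trans (sym (m∸[m∸n]≡n J≤r₁)) (trans (cong (r₁ ∸_) h) (m∸[m∸n]≡n J′≤r₁))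

module Column (r₁ : ℕ) where
  open import Data.Nat using (ℕ; zero; suc; _+_; _∸_; _<_; _≤_; s≤s; z≤n; _<?_; _≟_)
  open import Data.Nat.Properties
    using (+-cancelˡ-≤; +-comm; +-identityʳ; +-mono-<; +-monoˡ-<; 0≢1+n; <-asym; <-irrefl; <⇒≤; <⇒≱;
           m+n∸m≡n; m<n+m; m∸n+n≡m; m∸n≤m; m≤n+m; n≢0⇒n>0; ∸-monoˡ-<; ≤-antisym; ≤-refl; ≤-reflexive;
           ≤∧≢⇒<; ≮⇒≥)
  open import Data.Nat.DivMod using (_%_; n%n≡0; m<n⇒m%n≡m; m≤n⇒[n∸m]%m≡n%m)
  open import Data.Product using (_×_; _,_)
  open import Data.Sum using (_⊎_; inj₁; inj₂)
  open import Relation.Nullary using (Dec; yes; no; ¬_)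
  open import Relation.Binary.PropositionalEquality using (_≡_; refl; sym; trans; cong; subst)
  open import Data.Empty using (⊥-elim)
  open import Function.Bundles using (_⇔_; mk⇔; Equivalence)

  open Equivalence

  private
    R = suc r₁

  shift-cases : ∀ c J → c < R → J < R →
    (c ≡ 0 × (c + J) % R ≡ J)
    ⊎ (0 < c × c + J < R × J < (c + J) % R)
    ⊎ (0 < c × R ≤ c + J × (c + J) % R < J)
  shift-cases zero J _ J<R = inj₁ (refl , m<n⇒m%n≡m J<R)
  shift-cases (suc c) J c<R J<R with suc c + J <? R
  ... | yes no-wrap = inj₂ (inj₁ (s≤s z≤n , no-wrap , subst (J <_) (sym (m<n⇒m%n≡m no-wrap)) (m<n+m J (s≤s z≤n))))
  ... | no ¬no-wrap = inj₂ (inj₂ (s≤s z≤n , wrap , subst (_< J) wrapped drop))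
    where
    wrap : R ≤ suc c + J
    wrap = ≮⇒≥ ¬no-wrap
    drop : suc c + J ∸ R < J
    drop = subst (suc c + J ∸ R <_) (m+n∸m≡n R J) (∸-monoˡ-< (+-monoˡ-< J c<R) wrap)
    wrapped : suc c + J ∸ R ≡ (suc c + J) % R
    wrapped = trans (sym (m<n⇒m%n≡m (subst (suc c + J ∸ R <_) (m+n∸m≡n R R) (∸-monoˡ-< (+-mono-< c<R J<R) wrap))))
                    (m≤n⇒[n∸m]%m≡n%m wrap)

  threshold-≤ : ∀ u v → u ≤ R → (∀ J → J < R → R ≤ J + u → R ≤ J + v) → u ≤ v
  threshold-≤ zero v _ _ = z≤n
  threshold-≤ (suc u) v u≤R u⇒v = +-cancelˡ-≤ J (suc u) v (subst (_≤ J + v) R≡J+u (u⇒v J J<R (≤-reflexive R≡J+u)))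
    where
    J = R ∸ suc u
    J<R : J < R
    J<R = s≤s (m∸n≤m r₁ u)
    R≡J+u : R ≡ J + suc u
    R≡J+u = sym (m∸n+n≡m u≤R)

  threshold-unique : ∀ u v → u ≤ R → v ≤ R → (∀ J → J < R → (R ≤ J + u) ⇔ (R ≤ J + v)) → u ≡ v
  threshold-unique u v u≤R v≤R u⇔v =
    ≤-antisym (threshold-≤ u v u≤R (λ J J<R → to (u⇔v J J<R))) (threshold-≤ v u v≤R (λ J J<R → from (u⇔v J J<R)))

  -- Entry J of a column whose letter is sent to color c + J (mod R), X meaning that
  -- the letter's number grows: an excedance iff c = 0 and X, or the color wraps around.
  Excedance : ℕ → Set → ℕ → Set
  Excedance c X J = (c ≡ 0 × X) ⊎ (0 < c × R ≤ c + J)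

  -- The column has excedances exactly in its top e rows (those with R ≤ J + e).
  TopExcedances : ℕ → Set → ℕ → Set
  TopExcedances c X e = ∀ J → J < R → Excedance c X J ⇔ (R ≤ J + e)

  -- When c = 0 the tops is constant in J, so e ∈ {0, R} is decided by X;
  -- when c > 0 the tops is the threshold c, so e = c.
  top-excedances⇒ : ∀ c e {X : Set} → Dec X → c < R → e ≤ R → TopExcedances c X e →
    c ≡ e % R × (e ≡ 0 → ¬ X) × (e ≡ R → X)
  top-excedances⇒ zero e (yes x) _ e≤R tops =
    sym (trans (cong (_% R) e≡R) (n%n≡0 R)) , (λ e≡0 _ → 0≢1+n (trans (sym e≡0) e≡R)) , (λ _ → x)
    where
    e≡R : e ≡ R
    e≡R = sym (threshold-unique R e ≤-refl e≤R (λ J J<R →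
            mk⇔ (λ _ → to (tops J J<R) (inj₁ (refl , x))) (λ _ → m≤n+m R J)))
  top-excedances⇒ zero e (no ¬x) _ e≤R tops =
    cong (_% R) (sym e≡0) , (λ _ → ¬x) , (λ e≡R → ⊥-elim (0≢1+n (trans (sym e≡0) e≡R)))
    where
    never : ∀ {J} → ¬ Excedance 0 _ J
    never (inj₁ (_ , x)) = ¬x x
    never (inj₂ (() , _))
    e≡0 : e ≡ 0
    e≡0 = sym (threshold-unique 0 e z≤n e≤R (λ J J<R →
            mk⇔ (λ R≤J → ⊥-elim (<⇒≱ J<R (subst (R ≤_) (+-identityʳ J) R≤J)))
                (λ R≤J+e → ⊥-elim (never (from (tops J J<R) R≤J+e)))))
  top-excedances⇒ (suc c) e _ c<R e≤R tops =
    trans c≡e (sym (m<n⇒m%n≡m (subst (_< R) c≡e c<R))) ,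
    (λ e≡0 → ⊥-elim (0≢1+n (trans (sym e≡0) (sym c≡e)))) ,
    (λ e≡R → ⊥-elim (<-irrefl (trans c≡e e≡R) c<R))
    where
    wraps : ∀ J → Excedance (suc c) _ J ⇔ (R ≤ J + suc c)
    wraps J = mk⇔ (λ { (inj₁ (() , _)) ; (inj₂ (_ , w)) → subst (R ≤_) (+-comm (suc c) J) w })
                  (λ w → inj₂ (s≤s z≤n , subst (R ≤_) (+-comm J (suc c)) w))
    c≡e : suc c ≡ e
    c≡e = threshold-unique (suc c) e (<⇒≤ c<R) e≤R (λ J J<R →
            mk⇔ (λ w → to (tops J J<R) (from (wraps J) w)) (λ w → to (wraps J) (from (tops J J<R) w)))

  top-excedances⇐ : ∀ c e {X : Set} → c < R → e ≤ R → c ≡ e % R → (e ≡ 0 → ¬ X) → (e ≡ R → X) →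
    TopExcedances c X e
  top-excedances⇐ c e c<R e≤R c≡e%R e≡0⇒¬X e≡R⇒X J J<R with e ≟ R | e ≟ 0
  ... | yes refl | _ =
    mk⇔ (λ _ → m≤n+m R J) (λ _ → inj₁ (trans c≡e%R (n%n≡0 R) , e≡R⇒X refl))
  ... | no _ | yes refl =
    mk⇔ (λ { (inj₁ (_ , x)) → ⊥-elim (e≡0⇒¬X refl x) ; (inj₂ (0<c , _)) → ⊥-elim (<-irrefl (sym c≡e%R) 0<c) })
        (λ R≤J → ⊥-elim (<⇒≱ J<R (subst (R ≤_) (+-identityʳ J) R≤J)))
  ... | no e≢R | no e≢0 =
    mk⇔ (λ { (inj₁ (c≡0 , _)) → ⊥-elim (e≢0 (trans (sym c≡e) c≡0))
           ; (inj₂ (_ , w)) → subst (R ≤_) (trans (+-comm c J) (cong (J +_) c≡e)) w })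
        (λ w → inj₂ (subst (0 <_) (sym c≡e) (n≢0⇒n>0 e≢0) , subst (R ≤_) (trans (+-comm J e) (cong (_+ J) (sym c≡e))) w))
    where
    c≡e : c ≡ e
    c≡e = trans c≡e%R (m<n⇒m%n≡m (≤∧≢⇒< e≤R e≢R))

  -- Comparing entry J with its image color (c + J) mod R in the color order: the image
  -- lies in a higher row, or in the same row with X; this is exactly an excedance.
  image-above⇔excedance : ∀ c J {X : Set} → c < R → J < R →
    ((c + J) % R < J ⊎ ((c + J) % R ≡ J × X)) ⇔ Excedance c X J
  image-above⇔excedance c J c<R J<R with shift-cases c J c<R J<R
  ... | inj₁ (c≡0 , same) = mk⇔
    (λ { (inj₁ lower) → ⊥-elim (<-irrefl same lower) ; (inj₂ (_ , x)) → inj₁ (c≡0 , x) })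
    (λ { (inj₁ (_ , x)) → inj₂ (same , x) ; (inj₂ (0<c , _)) → ⊥-elim (<-irrefl (sym c≡0) 0<c) })
  ... | inj₂ (inj₁ (0<c , no-wrap , higher)) = mk⇔
    (λ { (inj₁ lower) → ⊥-elim (<-asym lower higher) ; (inj₂ (same , _)) → ⊥-elim (<-irrefl (sym same) higher) })
    (λ { (inj₁ (c≡0 , _)) → ⊥-elim (<-irrefl (sym c≡0) 0<c) ; (inj₂ (_ , wrap)) → ⊥-elim (<⇒≱ no-wrap wrap) })
  ... | inj₂ (inj₂ (0<c , wrap , lower)) = mk⇔ (λ _ → inj₂ (0<c , wrap)) (λ _ → inj₁ lower)

module Word where
  open import Data.Nat using (ℕ; zero; suc; _+_; _*_; _∸_; _<_; _≤_; s≤s; z≤n; _<?_)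
  open import Data.Nat.Properties
    using (*-monoˡ-≤; +-assoc; +-comm; +-mono-≤; +-suc; <⇒≱; m∸[m∸n]≡n; m∸n≤m; ≤-pred; ≤-trans; ≮⇒≥)
  open import Data.Nat.DivMod using (_%_; _/_; m%n<n; m≡m%n+[m/n]*n)
  open import Data.List using (List; _∷_; map; concat; concatMap; _++_; allFin; tabulate; reverse; replicate; applyUpTo; applyDownFrom)
  open import Data.List.Properties
    using (map-cong; map-∘; map-tabulate; concatMap-cong; ∷-injective; reverse-map; reverse-applyDownFrom;
           map-applyUpTo)
  open import Data.Fin using (Fin; toℕ; fromℕ<)
  open import Data.Fin.Properties using (toℕ-fromℕ<; toℕ-injective; toℕ<n)
  open import Data.Product using (_×_; _,_; proj₁; proj₂)
  open import Relation.Nullary using (yes; no; ¬_)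
  open import Relation.Binary.PropositionalEquality using (_≡_; refl; sym; trans; cong; cong₂; subst; module ≡-Reasoning)
  open import Data.Empty using (⊥-elim)
  open import Function using (_∘_; id)
  open import Function.Bundles using (_⇔_; mk⇔; Equivalence)
  open import Defs
  open Lex using (lex-≡)

  open Equivalence

  letter : ℕ → ℕ → AB
  letter x y with x <? y
  ... | yes _ = b
  ... | no _ = a

  letter-b : ∀ {x y} → x < y → letter x y ≡ b
  letter-b {x} {y} x<y with x <? y
  ... | yes _ = refl
  ... | no x≮y = ⊥-elim (x≮y x<y)

  letter-a : ∀ {x y} → ¬ x < y → letter x y ≡ a
  letter-a {x} {y} x≮y with x <? y
  ... | yes x<y = ⊥-elim (x≮y x<y)
  ... | no _ = refl

  letter-≡ : ∀ x y z → (letter x y ≡ letter x z) ⇔ ((x < y) ⇔ (x < z))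
  letter-≡ x y z = mk⇔ forth back
    where
    forth : letter x y ≡ letter x z → (x < y) ⇔ (x < z)
    forth e with x <? y | x <? z
    ... | yes p | yes q = mk⇔ (λ _ → q) (λ _ → p)
    ... | no p | no q = mk⇔ (⊥-elim ∘ p) (⊥-elim ∘ q)
    forth () | yes _ | no _
    forth () | no _ | yes _
    back : (x < y) ⇔ (x < z) → letter x y ≡ letter x z
    back y⇔z with x <? y | x <? z
    ... | yes _ | yes _ = refl
    ... | no _ | no _ = refl
    ... | yes p | no q = ⊥-elim (q (to y⇔z p))
    ... | no p | yes q = ⊥-elim (p (from y⇔z q))

  entry≡letter : ∀ {n r} (π : ColMap n r) i j → entry π i j ≡ letter (colorKey (i , j)) (colorKey (π i j))
  entry≡letter π i j with colorKey (i , j) <? colorKey (π i j)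
  ... | yes _ = refl
  ... | no _ = refl

  map-allFin : ∀ {A : Set} m (g : ℕ → A) → map (g ∘ toℕ) (allFin m) ≡ applyUpTo g m
  map-allFin m g = trans (map-tabulate id (g ∘ toℕ)) (tabulate≡applyUpTo m g)
    where
    tabulate≡applyUpTo : ∀ {A : Set} m (g : ℕ → A) → tabulate {n = m} (g ∘ toℕ) ≡ applyUpTo g m
    tabulate≡applyUpTo zero g = refl
    tabulate≡applyUpTo (suc m) g = cong (g 0 ∷_) (tabulate≡applyUpTo m (g ∘ suc))

  applyUpTo-cong : ∀ {A : Set} m {f g : ℕ → A} → (∀ x → f x ≡ g x) → applyUpTo f m ≡ applyUpTo g m
  applyUpTo-cong zero _ = refl
  applyUpTo-cong (suc m) f≗g = cong₂ _∷_ (f≗g 0) (applyUpTo-cong m (f≗g ∘ suc))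

  applyUpTo-++ : ∀ {A : Set} m m′ (f : ℕ → A) → applyUpTo f (m + m′) ≡ applyUpTo f m ++ applyUpTo (λ x → f (m + x)) m′
  applyUpTo-++ zero m′ f = refl
  applyUpTo-++ (suc m) m′ f = cong (f 0 ∷_) (applyUpTo-++ m m′ (f ∘ suc))

  applyUpTo-injective : ∀ {A : Set} m {f g : ℕ → A} → applyUpTo f m ≡ applyUpTo g m → ∀ p → p < m → f p ≡ g p
  applyUpTo-injective (suc m) e zero _ = proj₁ (∷-injective e)
  applyUpTo-injective (suc m) e (suc p) (s≤s p<m) = applyUpTo-injective m (proj₂ (∷-injective e)) p p<m

  dropLast-applyUpTo : ∀ {A : Set} m (f : ℕ → A) → dropLast (applyUpTo f (suc m)) ≡ applyUpTo f m
  dropLast-applyUpTo zero f = refl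
  dropLast-applyUpTo (suc m) f = cong (f 0 ∷_) (dropLast-applyUpTo m (f ∘ suc))

  concat-blocks : ∀ {A : Set} N m (g : ℕ → A) →
    concat (applyUpTo (λ ρ → applyUpTo (λ x → g (ρ * N + x)) N) m) ≡ applyUpTo g (m * N)
  concat-blocks N zero g = refl
  concat-blocks N (suc m) g =
    trans (cong (applyUpTo g N ++_)
            (trans (cong concat (applyUpTo-cong m (λ ρ → applyUpTo-cong N (λ x → cong g (+-assoc N (ρ * N) x)))))
                   (concat-blocks N m (λ y → g (N + y)))))
          (sym (applyUpTo-++ N (m * N) g))

  -- Reading the colors from r₁ down to 0 means reading the rows ρ = r₁ ∸ j upwards.
  rows-downwards : ∀ r₁ → applyUpTo (r₁ ∸_) (suc r₁) ≡ applyDownFrom id (suc r₁)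
  rows-downwards zero = refl
  rows-downwards (suc r₁) = cong (suc r₁ ∷_) (rows-downwards r₁)

  threshold-word : ∀ k M → k ≤ M → applyUpTo (λ p → letter p k) M ≡ replicate k b ++ replicate (M ∸ k) a
  threshold-word zero M _ = all-a M 0
    where
    all-a : ∀ M o → applyUpTo (λ p → letter (o + p) 0) M ≡ replicate M a
    all-a zero o = refl
    all-a (suc M) o = cong₂ _∷_ (letter-a {o + 0} {0} (λ ()))
      (trans (applyUpTo-cong M (λ x → cong (λ z → letter z 0) (sym (+-suc o x)))) (all-a M (suc o)))
  threshold-word (suc k) (suc M) (s≤s k≤M) =
    cong₂ _∷_ (letter-b {0} {suc k} (s≤s z≤n)) (trans (applyUpTo-cong M letter-suc) (threshold-word k M k≤M))
    where
    letter-suc : ∀ x → letter (suc x) (suc k) ≡ letter x k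
    letter-suc x with x <? k
    ... | yes x<k = letter-b (s≤s x<k)
    ... | no x≮k = letter-a (x≮k ∘ ≤-pred)

  module _ (n₁ r₁ : ℕ) where
    private
      N = suc n₁
      R = suc r₁

    -- The last position of the reading, R * N ∸ 1.
    lastPos : ℕ
    lastPos = n₁ + r₁ * N

    key : Fin N → Fin R → ℕ
    key i j = colorKey (i , j)

    key≤lastPos : ∀ (x : ColElem N R) → colorKey x ≤ lastPos
    key≤lastPos (i , j) = subst ((r₁ ∸ toℕ j) * N + toℕ i ≤_) (+-comm (r₁ * N) n₁)
      (+-mono-≤ (*-monoˡ-≤ N (m∸n≤m r₁ (toℕ j))) (≤-pred (toℕ<n i)))

    -- The excedance word reads M(π) in the color order: entry (i , j) at position key i j.
    reading-order : ∀ {A : Set} (g : ℕ → A) →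
      concatMap (λ j → map (λ i → g (key i j)) (allFin N)) (reverse (allFin R)) ≡ applyUpTo g (R * N)
    reading-order g = begin
      concat (map (λ j → map (λ i → g (key i j)) (allFin N)) (reverse (allFin R)))
        ≡⟨ cong concat (map-cong (λ j → map-allFin N (λ x → g ((r₁ ∸ toℕ j) * N + x))) (reverse (allFin R))) ⟩
      concat (map (block ∘ row) (reverse (allFin R)))
        ≡⟨ cong concat (map-∘ (reverse (allFin R))) ⟩
      concat (map block (map row (reverse (allFin R))))
        ≡⟨ cong (concat ∘ map block) rows ⟩
      concat (map block (applyUpTo id R))
        ≡⟨ cong concat (map-applyUpTo id block R) ⟩
      concat (applyUpTo block R)
        ≡⟨ concat-blocks N R g ⟩
      applyUpTo g (R * N) ∎
      where
      open ≡-Reasoning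
      block : ℕ → List _
      block ρ = applyUpTo (λ x → g (ρ * N + x)) N
      row : Fin R → ℕ
      row j = r₁ ∸ toℕ j
      rows : map row (reverse (allFin R)) ≡ applyUpTo id R
      rows = begin
        map row (reverse (allFin R))        ≡⟨ reverse-map row (allFin R) ⟩
        reverse (map row (allFin R))        ≡⟨ cong reverse (map-allFin R (r₁ ∸_)) ⟩
        reverse (applyUpTo (r₁ ∸_) R)       ≡⟨ cong reverse (rows-downwards r₁) ⟩
        reverse (applyDownFrom id R)        ≡⟨ reverse-applyDownFrom id R ⟩
        applyUpTo id R                      ∎

    columnAt : ℕ → Fin N
    columnAt p = fromℕ< (m%n<n p N)

    colorAt : ℕ → Fin R
    colorAt p = fromℕ< {r₁ ∸ p / N} (s≤s (m∸n≤m r₁ (p / N)))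

    key-inverse : ∀ i j → columnAt (key i j) ≡ i × colorAt (key i j) ≡ j
    key-inverse i j = toℕ-injective (trans (toℕ-fromℕ< _) (sym (proj₂ parts))) ,
                      toℕ-injective (trans (toℕ-fromℕ< _) (trans (cong (r₁ ∸_) (sym (proj₁ parts)))
                        (m∸[m∸n]≡n (≤-pred (toℕ<n j)))))
      where
      p = key i j
      parts = lex-≡ {N} (r₁ ∸ toℕ j) (p / N) (toℕ i) (p % N) (toℕ<n i) (m%n<n p N)
                (trans (m≡m%n+[m/n]*n p N) (+-comm (p % N) ((p / N) * N)))

    excWord-threshold : ∀ k → k ≤ lastPos → (π : ColMap N R) →
      (excWord π ≡ bkWord R N k) ⇔ (∀ i j → entry π i j ≡ letter (key i j) k)
    excWord-threshold k k≤last π = mk⇔ forth back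
      where
      G : ℕ → AB
      G p = entry π (columnAt p) (colorAt p)
      entry≡G : ∀ i j → entry π i j ≡ G (key i j)
      entry≡G i j = sym (cong₂ (entry π) (proj₁ (key-inverse i j)) (proj₂ (key-inverse i j)))
      reading : ∀ (g : ℕ → AB) → (∀ i j → entry π i j ≡ g (key i j)) → excWord π ≡ applyUpTo g lastPos
      reading g entries = trans
        (cong dropLast (trans (concatMap-cong (λ j → map-cong (λ i → entries i j) (allFin N)) (reverse (allFin R)))
                              (reading-order g)))
        (dropLast-applyUpTo lastPos g)
      back : (∀ i j → entry π i j ≡ letter (key i j) k) → excWord π ≡ bkWord R N k
      back entries = trans (reading (λ p → letter p k) entries) (threshold-word k lastPos k≤last)
      forth : excWord π ≡ bkWord R N k → ∀ i j → entry π i j ≡ letter (key i j) k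
      forth w i j with key i j <? lastPos
      ... | yes inside = trans (entry≡G i j) (applyUpTo-injective lastPos
              (trans (sym (reading G entry≡G)) (trans w (sym (threshold-word k lastPos k≤last)))) (key i j) inside)
      ... | no outside = trans (entry≡letter π i j)
              (trans (letter-a (λ lt → <⇒≱ lt (≤-trans (key≤lastPos (π i j)) last≤key)))
                     (sym (letter-a (λ lt → <⇒≱ lt (≤-trans k≤last last≤key)))))
        where
        last≤key : lastPos ≤ key i j
        last≤key = ≮⇒≥ outside

module Reduction (n₁ r₁ q s : ℕ) (s<N : s < suc n₁) (k≤last : q * suc n₁ + s ≤ Word.lastPos n₁ r₁) where
  open import Data.Nat using (zero; _∸_; s≤s; _<?_; _≤?_; _≟_)
  open import Data.Nat.Properties
    using (*-monoˡ-≤; +-comm; +-identityʳ; +-monoˡ-<; 0≢1+n; <⇒≱; m≤m+n; m≤n⇒m≤1+n; ≤-pred; ≤-refl;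
           ≤-trans; ≮⇒≥; ≰⇒>)
  open import Data.Nat.DivMod using (_%_; m%n<n)
  open import Data.Fin using (Fin; toℕ; fromℕ<) renaming (zero to fzero)
  open import Data.Fin.Properties using (toℕ-fromℕ<; toℕ-injective; toℕ<n)
  open import Data.Product using (_×_; _,_; proj₁; proj₂; ∃)
  open import Data.Product.Function.NonDependent.Propositional using (_×-⇔_)
  open import Data.Sum using (_⊎_)
  open import Data.Sum.Function.Propositional using (_⊎-⇔_)
  open import Relation.Nullary using (Dec; yes; no)
  open import Relation.Nullary.Decidable using (_×-dec_; _→-dec_)
  open import Relation.Binary.PropositionalEquality using (_≡_; _≢_; refl; sym; trans; cong; cong₂; subst)
  open import Data.Empty using (⊥-elim)
  open import Function using (_∘_; id)
  open import Function.Bundles using (_⇔_; mk⇔; Equivalence)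
  open import Function.Construct.Composition using (_⇔-∘_)
  open import Function.Construct.Symmetry using (⇔-sym)
  open import Defs
  open Counting using (length-filter≡count)
  open Listings using (count-bijection; colMapListing; endoListing)
  open Placements
  open Colors
  open Lex
  open Column r₁
  open Word

  open Equivalence

  N = suc n₁
  R = suc r₁
  k = q * N + s

  -- Column i of the target matrix has b exactly in its top 'tops i' rows.
  tops : ℕ → ℕ
  tops i = q + below s i

  q≤r₁ : q ≤ r₁
  q≤r₁ with q ≤? r₁
  ... | yes q≤r₁ = q≤r₁
  ... | no q≰r₁ = ⊥-elim (<⇒≱ last<RN (≤-trans (*-monoˡ-≤ N (≰⇒> q≰r₁)) (≤-trans (m≤m+n (q * N) s) k≤last)))
    where
    last<RN : lastPos n₁ r₁ < R * N
    last<RN = +-monoˡ-< (r₁ * N) {n₁} {N} ≤-refl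

  tops≤R : ∀ i → tops i ≤ R
  tops≤R i with i <? s
  ... | yes _ = subst (_≤ R) (+-comm 1 q) (s≤s q≤r₁)
  ... | no _ = subst (_≤ R) (sym (+-identityʳ q)) (m≤n⇒m≤1+n q≤r₁)

  -- The constraint on σ(i): a column without b's must not raise i, a column of b's must.
  Allowed : ℕ → Fin N → Set
  Allowed i t = (tops i ≡ 0 → toℕ t ≤ i) × (tops i ≡ R → i < toℕ t)

  allowed? : ∀ i t → Dec (Allowed i t)
  allowed? i t = (tops i ≟ 0 →-dec toℕ t ≤? i) ×-dec (tops i ≟ R →-dec i <? toℕ t)

  allowed-free : ∀ i t → tops i ≢ 0 → tops i ≢ R → Allowed i t
  allowed-free i t ≢0 ≢R = (λ e → ⊥-elim (≢0 e)) , (λ e → ⊥-elim (≢R e))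

  allowed-empty : ∀ i t → tops i ≡ 0 → Allowed i t ⇔ (toℕ t ≤ i)
  allowed-empty i t ≡0 =
    mk⇔ (λ (t≤i , _) → t≤i ≡0) (λ t≤i → (λ _ → t≤i) , (λ ≡R → ⊥-elim (0≢1+n (trans (sym ≡0) ≡R))))

  allowed-full : ∀ i t → tops i ≡ R → Allowed i t ⇔ (i < toℕ t)
  allowed-full i t ≡R =
    mk⇔ (λ (_ , i<t) → i<t ≡R) (λ i<t → (λ ≡0 → ⊥-elim (0≢1+n (trans (sym ≡0) ≡R))) , (λ _ → i<t))

  shiftOf : Fin N → Fin R
  shiftOf i = fromℕ< (m%n<n (tops (toℕ i)) R)

  key-< : ∀ (i t : Fin N) (j j′ : Fin R) →
    (key n₁ r₁ i j < key n₁ r₁ t j′) ⇔ (toℕ j′ < toℕ j ⊎ (toℕ j′ ≡ toℕ j × toℕ i < toℕ t))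
  key-< i t j j′ =
    (row-<-flip r₁ (toℕ j) (toℕ j′) J≤r₁ ⊎-⇔ (rows-≡ ×-⇔ mk⇔ id id))
    ⇔-∘ lex-< (r₁ ∸ toℕ j) (r₁ ∸ toℕ j′) (toℕ i) (toℕ t) (toℕ<n i) (toℕ<n t)
    where
    J≤r₁ = ≤-pred (toℕ<n j)
    rows-≡ : (r₁ ∸ toℕ j ≡ r₁ ∸ toℕ j′) ⇔ (toℕ j′ ≡ toℕ j)
    rows-≡ = mk⇔ (sym ∘ row-≡ r₁ (toℕ j) (toℕ j′) J≤r₁ (≤-pred (toℕ<n j′))) (cong (r₁ ∸_) ∘ sym)

  excedance⇔ : ∀ (i t : Fin N) (c j : Fin R) →
    (key n₁ r₁ i j < key n₁ r₁ t (shift c j)) ⇔ Excedance (toℕ c) (toℕ i < toℕ t) (toℕ j)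
  excedance⇔ i t c j =
    image-above⇔excedance (toℕ c) (toℕ j) (toℕ<n c) (toℕ<n j)
    ⇔-∘ subst (λ J′ → (key n₁ r₁ i j < key n₁ r₁ t (shift c j))
                         ⇔ (J′ < toℕ j ⊎ (J′ ≡ toℕ j × toℕ i < toℕ t)))
              (toℕ-shift c j) (key-< i t j (shift c j))

  below-k⇔ : ∀ (i : Fin N) (j : Fin R) → (key n₁ r₁ i j < k) ⇔ (R ≤ toℕ j + tops (toℕ i))
  below-k⇔ i j =
    row-< r₁ (toℕ j) (tops (toℕ i)) (≤-pred (toℕ<n j))
    ⇔-∘ lex-<-threshold q s (r₁ ∸ toℕ j) (toℕ i) s<N (toℕ<n i)

  ColumnMatches : Fin N → Fin N → Fin R → Set
  ColumnMatches i t c = ∀ j → (key n₁ r₁ i j < key n₁ r₁ t (shift c j)) ⇔ (key n₁ r₁ i j < k)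

  column-matches⇔ : ∀ i t c → ColumnMatches i t c ⇔ (toℕ c ≡ tops (toℕ i) % R × Allowed (toℕ i) t)
  column-matches⇔ i t c = mk⇔ forth back
    where
    X = toℕ i < toℕ t
    as-tops : ColumnMatches i t c → TopExcedances (toℕ c) X (tops (toℕ i))
    as-tops matches J J<R = subst (λ J → Excedance (toℕ c) X J ⇔ (R ≤ J + tops (toℕ i))) (toℕ-fromℕ< J<R)
      (below-k⇔ i j ⇔-∘ (matches j ⇔-∘ ⇔-sym (excedance⇔ i t c j)))
      where j = fromℕ< J<R
    forth : ColumnMatches i t c → toℕ c ≡ tops (toℕ i) % R × Allowed (toℕ i) t
    forth matches with top-excedances⇒ (toℕ c) (tops (toℕ i)) (toℕ i <? toℕ t) (toℕ<n c) (tops≤R (toℕ i)) (as-tops matches)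
    ... | c≡e , e≡0⇒¬X , e≡R⇒X = c≡e , (λ e≡0 → ≮⇒≥ (e≡0⇒¬X e≡0)) , e≡R⇒X
    back : toℕ c ≡ tops (toℕ i) % R × Allowed (toℕ i) t → ColumnMatches i t c
    back (c≡e , t≤i , i<t) j =
      ⇔-sym (below-k⇔ i j)
      ⇔-∘ (top-excedances⇐ (toℕ c) (tops (toℕ i)) (toℕ<n c) (tops≤R (toℕ i)) c≡e
             (λ e≡0 i<t′ → <⇒≱ i<t′ (t≤i e≡0)) i<t (toℕ j) (toℕ<n j)
           ⇔-∘ excedance⇔ i t c j)

  underlying : ColMap N R → (Fin N → Fin N)
  underlying π i = proj₁ (π i fzero)

  lift : (Fin N → Fin N) → ColMap N R
  lift σ i j = (σ i , shift (shiftOf i) j)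

  entry-matches : ∀ (π : ColMap N R) i j t c → π i j ≡ (t , shift c j) →
    (entry π i j ≡ letter (key n₁ r₁ i j) k) ⇔ ((key n₁ r₁ i j < key n₁ r₁ t (shift c j)) ⇔ (key n₁ r₁ i j < k))
  entry-matches π i j t c π-ij =
    subst (λ z → (z ≡ letter (key n₁ r₁ i j) k) ⇔ _)
          (sym (trans (entry≡letter π i j) (cong (λ x → letter (key n₁ r₁ i j) (colorKey x)) π-ij)))
          (letter-≡ (key n₁ r₁ i j) (key n₁ r₁ t (shift c j)) k)

  excWord-target⇔ : ∀ (π : ColMap N R) →
    (excWord π ≡ bkWord R N k) ⇔ (∀ i j → entry π i j ≡ letter (key n₁ r₁ i j) k)
  excWord-target⇔ = excWord-threshold n₁ r₁ k k≤last

  target⇒columns : ∀ π → IsColorCompatible π → excWord π ≡ bkWord R N k →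
    ∀ i → proj₂ (π i fzero) ≡ shiftOf i × Allowed (toℕ i) (underlying π i)
  target⇒columns π compatible word i =
    toℕ-injective (trans (proj₁ shape) (sym (toℕ-fromℕ< _))) , proj₂ shape
    where
    matches : ColumnMatches i (underlying π i) (proj₂ (π i fzero))
    matches j = to (entry-matches π i j (underlying π i) (proj₂ (π i fzero)) (compatible⇒shift π compatible i j))
                   (to (excWord-target⇔ π) word i j)
    shape = to (column-matches⇔ i (underlying π i) (proj₂ (π i fzero))) matches

  underlying-injective : ∀ π → IsColoredPerm π → IsInjective (underlying π)
  underlying-injective π ((π-inj , _) , compatible) i i′ σi≡σi′ = cong proj₁ (π-inj i fzero i′ j′ π-i0≡π-i′j′)
    where
    c = proj₂ (π i fzero)
    c′ = proj₂ (π i′ fzero)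
    j′ = unshift c′ c
    π-i0≡π-i′j′ : π i fzero ≡ π i′ j′
    π-i0≡π-i′j′ = sym (trans (compatible⇒shift π compatible i′ j′) (cong₂ _,_ (sym σi≡σi′) (shift-unshift c′ c)))

  module Lifted (π : ColMap N R) (σ : Fin N → Fin N) (π≗lift : ∀ i j → π i j ≡ lift σ i j) where

    coloredPerm : IsInjective σ → IsColoredPerm π
    coloredPerm σ-inj = (π-inj , π-surj) , π-compatible
      where
      π-inj : ∀ i j i′ j′ → π i j ≡ π i′ j′ → (i , j) ≡ (i′ , j′)
      π-inj i j i′ j′ e = same (σ-inj i i′ (cong proj₁ lifted)) (cong proj₂ lifted)
        where
        lifted : lift σ i j ≡ lift σ i′ j′
        lifted = trans (sym (π≗lift i j)) (trans e (π≗lift i′ j′))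
        same : i ≡ i′ → shift (shiftOf i) j ≡ shift (shiftOf i′) j′ → (i , j) ≡ (i′ , j′)
        same refl e′ = cong (i ,_) (shift-injective (shiftOf i) j j′ e′)
      π-surj : ∀ t y → ∃ λ i → ∃ λ j → π i j ≡ (t , y)
      π-surj t y with injective⇒surjective σ σ-inj t
      ... | i , σi≡t = i , unshift (shiftOf i) y , trans (π≗lift i _) (cong₂ _,_ σi≡t (shift-unshift (shiftOf i) y))
      π-compatible : IsColorCompatible π
      π-compatible i α = trans (π≗lift i (nextColor α))
        (trans (cong (σ i ,_) (shift-next (shiftOf i) α))
               (sym (cong (λ z → (proj₁ z , nextColor (proj₂ z))) (π≗lift i α))))

    word : (∀ i → Allowed (toℕ i) (σ i)) → excWord π ≡ bkWord R N k
    word allowed = from (excWord-target⇔ π) λ i j →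
      from (entry-matches π i j (σ i) (shiftOf i) (π≗lift i j))
           (from (column-matches⇔ i (σ i) (shiftOf i)) (toℕ-fromℕ< _ , allowed i) j)

  countWord≡placements : countWord R N (bkWord R N k) ≡ placements N N allowed?
  countWord≡placements =
    trans (length-filter≡count (hasWord? (bkWord R N k)) (allColMaps N R))
    (count-bijection (colMapListing N R) (endoListing N) (hasWord? (bkWord R N k)) (placement? allowed?)
      underlying lift forth back)
    where
    forth : ∀ π σ → HasWord (bkWord R N k) π → (∀ i → σ i ≡ underlying π i) →
            Placement Allowed σ × (∀ i j → π i j ≡ lift σ i j)
    forth π σ (perm@(_ , compatible) , word) σ≗ =
      (σ-inj , (λ i → subst (Allowed (toℕ i)) (sym (σ≗ i)) (proj₂ (columns i)))) ,
      (λ i j → trans (compatible⇒shift π compatible i j) (cong₂ (λ t c → (t , shift c j)) (sym (σ≗ i)) (proj₁ (columns i))))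
      where
      columns = target⇒columns π compatible word
      σ-inj : IsInjective σ
      σ-inj i i′ e = underlying-injective π perm i i′ (trans (sym (σ≗ i)) (trans e (σ≗ i′)))
    back : ∀ π σ → Placement Allowed σ → (∀ i j → π i j ≡ lift σ i j) →
           HasWord (bkWord R N k) π × (∀ i → σ i ≡ underlying π i)
    back π σ (σ-inj , allowed) π≗lift =
      (coloredPerm σ-inj , word allowed) , (λ i → sym (cong proj₁ (π≗lift i fzero)))
      where open Lifted π σ π≗lift

module Boards where
  open import Data.Nat using (ℕ; suc; _+_; _*_; _∸_; _^_; _!; _<_; _≤_; s≤s; _<?_; _≤?_)
  open import Data.Nat.Properties
    using (*-identityˡ; +-comm; +-identityʳ; +-monoʳ-<; +-monoʳ-≤; +-monoˡ-≤; +-∸-assoc; 0≢1+n;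
           <-irrefl; <-trans; <⇒≤; <⇒≱; m+[n∸m]≡n; m+n∸n≡m; m∸[m∸n]≡n; m∸n+n≡m; m∸n≤m; m≤m+n; n<1+n;
           n≤1+n; ∸-+-assoc; ∸-monoˡ-<; ∸-monoˡ-≤; ≤-<-trans; ≤-pred; ≤-refl; ≤-trans; ≮⇒≥)
  open import Data.Nat.DivMod using (_%_; m<n⇒m%n≡m; m≤n⇒[n∸m]%m≡n%m)
  open import Data.List using (allFin)
  open import Data.Fin using (Fin; toℕ; fromℕ<)
  open import Data.Fin.Properties using (toℕ-fromℕ<; toℕ-injective; toℕ<n)
  open import Data.Product using (_×_; _,_; proj₁; proj₂)
  open import Data.Unit using (⊤; tt)
  open import Relation.Nullary using (Dec; yes; no; ¬_)
  open import Relation.Nullary.Decidable using (_→-dec_)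
  open import Relation.Binary.PropositionalEquality using (_≡_; _≢_; refl; sym; trans; cong; subst; module ≡-Reasoning)
  open import Data.Empty using (⊥-elim)
  open import Function.Bundles using (_⇔_; mk⇔; Equivalence)
  open Counting using (count-⇔)
  open Listings using (count-everything; count-atMost; count-atLeast)
  open Placements
  open Colors using (shift; unshift; toℕ-shift; shift-unshift; unshift-shift)
  open Lex using (below-yes; below-no)
  open Word using (lastPos)
  open import Defs using (allFuns; countWord; bkWord)

  open Equivalence

  module Unconstrained (n₁ r₁ q s : ℕ) (s<N : s < suc n₁) (k≤last : q * suc n₁ + s ≤ lastPos n₁ r₁) where
    open Reduction n₁ r₁ q s s<N k≤last

    all-free : (∀ (i : Fin N) → tops (toℕ i) ≢ 0 × tops (toℕ i) ≢ R) → countWord R N (bkWord R N k) ≡ N !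
    all-free free = begin
      countWord R N (bkWord R N k)
        ≡⟨ countWord≡placements ⟩
      placements N N allowed?
        ≡⟨ count-⇔ (placement? allowed?) (placement? anywhere?) (allFuns N (allFin N)) (λ σ (inj , _) → inj , _)
             (λ σ (inj , _) → inj , λ i → allowed-free (toℕ i) (σ i) (proj₁ (free i)) (proj₂ (free i))) ⟩
      placements N N anywhere?
        ≡⟨ staircase-count N 0 N 1 anywhere? refl (λ _ _ _ → tt) (λ _ ())
             (λ j _ → cong (_∸ j) (count-everything N (anywhere? j) (λ _ → tt))) ⟩
      1 * N !
        ≡⟨ *-identityˡ (N !) ⟩
      N ! ∎
      where
      open ≡-Reasoning
      anywhere? : ∀ (i : ℕ) (t : Fin N) → Dec ⊤
      anywhere? _ _ = yes tt

  -- k = K < N: columns i ≥ K are empty (σ(i) ≤ i), columns i < K are free.  Rotating the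
  -- rows by K lists the constrained rows first, with nested sets {0, …, K + i}.
  module Low (n₁ r₁ K : ℕ) (r₁≥1 : 1 ≤ r₁) (K<N : K < suc n₁) where
    open Reduction n₁ r₁ 0 K K<N (≤-trans (≤-pred K<N) (m≤m+n n₁ _))

    rot rot⁻¹ : Fin N → Fin N
    rot = shift (fromℕ< K<N)
    rot⁻¹ = unshift (fromℕ< K<N)

    toℕ-rot : ∀ i → toℕ (rot i) ≡ (K + toℕ i) % N
    toℕ-rot i = trans (toℕ-shift (fromℕ< K<N) i) (cong (λ z → (z + toℕ i) % N) (toℕ-fromℕ< K<N))

    rot-straight : ∀ i → K + toℕ i < N → toℕ (rot i) ≡ K + toℕ i
    rot-straight i no-wrap = trans (toℕ-rot i) (m<n⇒m%n≡m no-wrap)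

    rot-wrap : ∀ i → ¬ (K + toℕ i < N) → toℕ (rot i) < K
    rot-wrap i wrap = subst (_< K) (trans value (sym (toℕ-rot i))) drop
      where
      N≤K+i = ≮⇒≥ wrap
      drop : K + toℕ i ∸ N < K
      drop = subst (K + toℕ i ∸ N <_) (m+n∸n≡m K N) (∸-monoˡ-< (+-monoʳ-< K (toℕ<n i)) N≤K+i)
      value : K + toℕ i ∸ N ≡ (K + toℕ i) % N
      value = trans (sym (m<n⇒m%n≡m (<-trans drop K<N)))
                    (m≤n⇒[n∸m]%m≡n%m N≤K+i)

    T : ℕ → Fin N → Set
    T i t = K + i < N → toℕ t ≤ K + i

    T? : ∀ i t → Dec (T i t)
    T? i t = (K + i <? N) →-dec (toℕ t ≤? K + i)

    nested : Nested T
    nested i t Tt K+i+1<N = ≤-trans (Tt (<-trans (+-monoʳ-< K (n<1+n i)) K+i+1<N)) (+-monoʳ-≤ K (n≤1+n i))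

    -- Row i of the rotated board is row K + i (mod N) of the original one.
    tops-straight : ∀ i → K + toℕ i < N → tops (toℕ (rot i)) ≡ 0
    tops-straight i no-wrap = below-no (λ lt → <⇒≱ (subst (_< K) (rot-straight i no-wrap) lt) (m≤m+n K (toℕ i)))

    allowed⇒T : ∀ i t → Allowed (toℕ (rot i)) t → T (toℕ i) t
    allowed⇒T i t ok no-wrap =
      subst (toℕ t ≤_) (rot-straight i no-wrap) (to (allowed-empty _ t (tops-straight i no-wrap)) ok)

    T⇒allowed : ∀ i t → T (toℕ i) t → Allowed (toℕ (rot i)) t
    T⇒allowed i t Tt with K + toℕ i <? N
    ... | yes no-wrap = from (allowed-empty _ t (tops-straight i no-wrap)) (subst (toℕ t ≤_) (sym (rot-straight i no-wrap)) (Tt no-wrap))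
    ... | no wrap = allowed-free _ t (λ e → 0≢1+n (trans (sym e) one)) (λ e → <-irrefl (trans (sym one) e) (s≤s r₁≥1))
      where
      one : tops (toℕ (rot i)) ≡ 1
      one = below-yes (rot-wrap i wrap)

    first : ∀ i → i < N ∸ K → allowed T? i ∸ i ≡ suc K
    first i i<N∸K = trans (cong (_∸ i) size) (m+n∸n≡m (suc K) i)
      where
      no-wrap : K + i < N
      no-wrap = subst (K + i <_) (m+[n∸m]≡n (<⇒≤ K<N)) (+-monoʳ-< K i<N∸K)
      size : allowed T? i ≡ suc (K + i)
      size = trans (count-⇔ (T? i) (λ t → toℕ t ≤? K + i) (allFin N) (λ t Tt → Tt no-wrap) (λ t le _ → le))
                   (count-atMost N (K + i) no-wrap)

    last : ∀ j → j < K → allowed T? (N ∸ K + j) ∸ (N ∸ K + j) ≡ K ∸ j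
    last j _ = trans (cong (_∸ (N ∸ K + j)) (count-everything N (T? (N ∸ K + j)) (λ t wraps → ⊥-elim (<⇒≱ wraps past))))
                     (trans (sym (∸-+-assoc N (N ∸ K) j)) (cong (_∸ j) (m∸[m∸n]≡n (<⇒≤ K<N))))
      where
      past : N ≤ K + (N ∸ K + j)
      past = subst (_≤ K + (N ∸ K + j)) (m+[n∸m]≡n (<⇒≤ K<N)) (+-monoʳ-≤ K (m≤m+n (N ∸ K) j))

    low-count : countWord R N (bkWord R N K) ≡ suc K ^ (N ∸ K) * K !
    low-count = begin
      countWord R N (bkWord R N K)   ≡⟨ countWord≡placements ⟩
      placements N N allowed?        ≡⟨ placements-relabel N allowed? T? rot rot⁻¹ (shift-unshift (fromℕ< K<N))
                                          (unshift-shift (fromℕ< K<N)) allowed⇒T T⇒allowed ⟩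
      placements N N T?              ≡⟨ staircase-count N (N ∸ K) K (suc K) T? (m∸n+n≡m (<⇒≤ K<N)) nested first last ⟩
      suc K ^ (N ∸ K) * K !          ∎
      where open ≡-Reasoning

  -- k = r₁ N + s₀: columns i < s₀ are full (σ(i) > i), the others are free.  Reversing
  -- the rows below s₀ lists the constrained rows first, with nested sets {s₀ − i, …}.
  module High (n₁ r₁ s₀ : ℕ) (r₁≥1 : 1 ≤ r₁) (s₀<N : s₀ < suc n₁) where
    open Reduction n₁ r₁ r₁ s₀ s₀<N
      (subst (r₁ * suc n₁ + s₀ ≤_) (+-comm (r₁ * suc n₁) n₁) (+-monoʳ-≤ (r₁ * suc n₁) (≤-pred s₀<N)))

    mirror : Fin N → Fin N
    mirror i with toℕ i <? s₀
    ... | yes _ = fromℕ< (≤-<-trans (m∸n≤m s₀ (suc (toℕ i))) s₀<N)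
    ... | no _ = i

    mirror-inside : ∀ i → toℕ i < s₀ → toℕ (mirror i) ≡ s₀ ∸ suc (toℕ i)
    mirror-inside i inside with toℕ i <? s₀
    ... | yes _ = toℕ-fromℕ< _
    ... | no outside = ⊥-elim (outside inside)

    mirror-outside : ∀ i → ¬ (toℕ i < s₀) → mirror i ≡ i
    mirror-outside i outside with toℕ i <? s₀
    ... | yes inside = ⊥-elim (outside inside)
    ... | no _ = refl

    mirrored-inside : ∀ i → toℕ i < s₀ → toℕ (mirror i) < s₀
    mirrored-inside i inside = subst (_< s₀) (sym (mirror-inside i inside))
      (subst (_≤ s₀) (+-∸-assoc 1 inside) (m∸n≤m s₀ (toℕ i)))

    mirror-involutive : ∀ i → mirror (mirror i) ≡ i
    mirror-involutive i = by-cases (toℕ i <? s₀)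
      where
      open ≡-Reasoning
      by-cases : Dec (toℕ i < s₀) → mirror (mirror i) ≡ i
      by-cases (yes inside) = toℕ-injective (begin
        toℕ (mirror (mirror i))          ≡⟨ mirror-inside (mirror i) (mirrored-inside i inside) ⟩
        s₀ ∸ suc (toℕ (mirror i))        ≡⟨ cong (λ z → s₀ ∸ suc z) (mirror-inside i inside) ⟩
        s₀ ∸ suc (s₀ ∸ suc (toℕ i))      ≡⟨ cong (s₀ ∸_) (sym (+-∸-assoc 1 inside)) ⟩
        s₀ ∸ (s₀ ∸ toℕ i)                ≡⟨ m∸[m∸n]≡n (<⇒≤ inside) ⟩
        toℕ i                            ∎)
      by-cases (no outside) = trans (cong mirror (mirror-outside i outside)) (mirror-outside i outside)

    T : ℕ → Fin N → Set
    T i t = i < s₀ → s₀ ≤ toℕ t + i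

    T? : ∀ i t → Dec (T i t)
    T? i t = (i <? s₀) →-dec (s₀ ≤? toℕ t + i)

    nested : Nested T
    nested i t Tt i+1<s₀ = ≤-trans (Tt (<-trans (n<1+n i) i+1<s₀)) (+-monoʳ-≤ (toℕ t) (n≤1+n i))

    tops-inside : ∀ i → i < s₀ → tops i ≡ R
    tops-inside i inside = trans (cong (r₁ +_) (below-yes inside)) (+-comm r₁ 1)

    mirrored-< : ∀ i t → i < s₀ → (s₀ ∸ suc i < t) ⇔ (s₀ ≤ t + i)
    mirrored-< i t inside = mk⇔
      (λ lt → subst (_≤ t + i) (m∸n+n≡m (<⇒≤ inside)) (+-monoˡ-≤ i (subst (_≤ t) (sym (+-∸-assoc 1 inside)) lt)))
      (λ le → subst (_≤ t) (+-∸-assoc 1 inside) (subst (s₀ ∸ i ≤_) (m+n∸n≡m t i) (∸-monoˡ-≤ i le)))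

    allowed⇒T : ∀ i t → Allowed (toℕ (mirror i)) t → T (toℕ i) t
    allowed⇒T i t ok inside = to (mirrored-< (toℕ i) (toℕ t) inside)
      (subst (_< toℕ t) (mirror-inside i inside)
        (to (allowed-full _ t (tops-inside _ (mirrored-inside i inside))) ok))

    T⇒allowed : ∀ i t → T (toℕ i) t → Allowed (toℕ (mirror i)) t
    T⇒allowed i t Tt = by-cases (toℕ i <? s₀)
      where
      r₁-tops : ¬ (toℕ i < s₀) → tops (toℕ i) ≡ r₁
      r₁-tops outside = trans (cong (r₁ +_) (below-no outside)) (+-identityʳ r₁)
      by-cases : Dec (toℕ i < s₀) → Allowed (toℕ (mirror i)) t
      by-cases (yes inside) = from (allowed-full _ t (tops-inside _ (mirrored-inside i inside)))
          (subst (_< toℕ t) (sym (mirror-inside i inside)) (from (mirrored-< (toℕ i) (toℕ t) inside) (Tt inside)))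
      by-cases (no outside) = subst (λ z → Allowed (toℕ z) t) (sym (mirror-outside i outside))
          (allowed-free _ t (λ e → <-irrefl (sym (trans (sym (r₁-tops outside)) e)) r₁≥1)
                            (λ e → <-irrefl (trans (sym (r₁-tops outside)) e) ≤-refl))

    first : ∀ i → i < s₀ → allowed T? i ∸ i ≡ N ∸ s₀
    first i inside = trans (cong (_∸ i) size) (trans (∸-+-assoc N (s₀ ∸ i) i) (cong (N ∸_) (m∸n+n≡m (<⇒≤ inside))))
      where
      size : allowed T? i ≡ N ∸ (s₀ ∸ i)
      size = trans (count-⇔ (T? i) (λ t → s₀ ∸ i ≤? toℕ t) (allFin N)
                      (λ t Tt → subst (s₀ ∸ i ≤_) (m+n∸n≡m (toℕ t) i) (∸-monoˡ-≤ i (Tt inside)))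
                      (λ t le _ → subst (_≤ toℕ t + i) (m∸n+n≡m (<⇒≤ inside)) (+-monoˡ-≤ i le)))
                   (count-atLeast N (s₀ ∸ i) (≤-trans (m∸n≤m s₀ i) (<⇒≤ s₀<N)))

    last : ∀ j → j < N ∸ s₀ → allowed T? (s₀ + j) ∸ (s₀ + j) ≡ N ∸ s₀ ∸ j
    last j _ = trans (cong (_∸ (s₀ + j)) (count-everything N (T? (s₀ + j)) (λ t inside → ⊥-elim (<⇒≱ inside (m≤m+n s₀ j)))))
                     (sym (∸-+-assoc N s₀ j))

    high-count : countWord R N (bkWord R N k) ≡ (N ∸ s₀) ^ s₀ * (N ∸ s₀) !
    high-count = begin
      countWord R N (bkWord R N k)   ≡⟨ countWord≡placements ⟩
      placements N N allowed?        ≡⟨ placements-relabel N allowed? T? mirror mirror mirror-involutive mirror-involutive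
                                          allowed⇒T T⇒allowed ⟩
      placements N N T?              ≡⟨ staircase-count N s₀ (N ∸ s₀) (N ∸ s₀) T? (m+[n∸m]≡n (<⇒≤ s₀<N))
                                          nested first last ⟩
      (N ∸ s₀) ^ s₀ * (N ∸ s₀) !     ∎
      where open ≡-Reasoning


open import Data.Nat using (s≤s; z≤n; _<?_)
open import Data.Nat.Properties
  using (*-comm; *-identityˡ; *-monoˡ-≤; *-suc; +-assoc; +-comm; +-identityʳ; +-monoʳ-≤; 0≢1+n;
         <-irrefl; [m+n]∸[m+o]≡n∸o; m+[n∸m]≡n; m+n∸n≡m; m+n≡0⇒m≡0; m≤m+n; m≤n+m; m≤n⇒m<n∨m≡n;
         n∸n≡0; n≤1+n; suc-injective; ∸-monoˡ-≤; ≤-reflexive; ≤-trans; module ≤-Reasoning)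
open import Data.Nat.DivMod using (_%_; _/_; m%n<n; m≡m%n+[m/n]*n; m≥n⇒m/n>0)
open import Data.Fin using (Fin; toℕ)
open import Data.Product using (_,_)
open import Data.Sum using (inj₁; inj₂)
open import Relation.Nullary using (Dec; yes; no)
open import Relation.Binary.PropositionalEquality using (_≢_; refl; sym; trans; cong; cong₂; subst; module ≡-Reasoning)
open Lex using (below; below-yes; below-no)
open Word using (lastPos)
open Boards

-- Below, n = suc n₁ = N and r = suc r₁ = R with r₁ ≥ 1.

-- 0 ≤ k ≤ N: for k < N the low board; k = N = 1 · N + 0 has every column of height 1.
count-low : ∀ n₁ r₁ → 1 ≤ r₁ → ∀ k → k ≤ suc n₁ →
  countWord (suc r₁) (suc n₁) (bkWord (suc r₁) (suc n₁) k) ≡ (k + 1) ^ (suc n₁ ∸ k) * k !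
count-low n₁ r₁ r₁≥1 k k≤N with m≤n⇒m<n∨m≡n k≤N
... | inj₁ k<N = trans (Low.low-count n₁ r₁ k r₁≥1 k<N) (cong (λ z → z ^ (suc n₁ ∸ k) * k !) (+-comm 1 k))
... | inj₂ refl = begin
  countWord R N (bkWord R N N)            ≡⟨ cong (λ z → countWord R N (bkWord R N z)) N≡1·N+0 ⟩
  countWord R N (bkWord R N (1 * N + 0))   ≡⟨ Unconstrained.all-free n₁ r₁ 1 0 (s≤s z≤n) bound heights ⟩
  N !                                      ≡⟨ sym (+-identityʳ (N !)) ⟩
  1 * N !                                  ≡⟨ cong (λ e → (N + 1) ^ e * N !) (sym (n∸n≡0 N)) ⟩
  (N + 1) ^ (N ∸ N) * N !                  ∎
  where
  open ≡-Reasoning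
  N = suc n₁
  R = suc r₁
  N≡1·N+0 : N ≡ 1 * N + 0
  N≡1·N+0 = sym (trans (+-identityʳ (1 * N)) (*-identityˡ N))
  bound : 1 * N + 0 ≤ lastPos n₁ r₁
  bound = subst (_≤ lastPos n₁ r₁) (sym (+-identityʳ (1 * N))) (≤-trans (*-monoˡ-≤ N r₁≥1) (m≤n+m (r₁ * N) n₁))
  heights : ∀ (i : Fin N) → 1 + below 0 (toℕ i) ≢ 0 × 1 + below 0 (toℕ i) ≢ R
  heights i = (λ e → 0≢1+n (sym (trans (sym one) e))) , (λ e → <-irrefl (trans (sym one) e) (s≤s r₁≥1))
    where
    one : 1 + below 0 (toℕ i) ≡ 1
    one = cong suc (below-no {0} {toℕ i} (λ ()))

full⇒beyond : ∀ n₁ r₁ q s i → q + below s i ≡ suc r₁ → r₁ * suc n₁ + 1 ≤ q * suc n₁ + s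
full⇒beyond n₁ r₁ q s i full = by-cases (i <? s)
  where
  open ≤-Reasoning
  N = suc n₁
  by-cases : Dec (i < s) → r₁ * N + 1 ≤ q * N + s
  by-cases (yes i<s) = begin
    r₁ * N + 1   ≤⟨ +-monoʳ-≤ (r₁ * N) (≤-trans (s≤s z≤n) i<s) ⟩
    r₁ * N + s   ≡⟨ cong (λ z → z * N + s) (sym q≡r₁) ⟩
    q * N + s    ∎
    where
    q≡r₁ : q ≡ r₁
    q≡r₁ = suc-injective (trans (+-comm 1 q) (trans (cong (q +_) (sym (below-yes i<s))) full))
  by-cases (no i≮s) = begin
    r₁ * N + 1   ≤⟨ +-monoʳ-≤ (r₁ * N) (s≤s z≤n) ⟩
    r₁ * N + N   ≡⟨ +-comm (r₁ * N) N ⟩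
    suc r₁ * N   ≡⟨ cong (_* N) (sym q≡R) ⟩
    q * N        ≤⟨ m≤m+n (q * N) s ⟩
    q * N + s    ∎
    where
    q≡R : q ≡ suc r₁
    q≡R = trans (sym (trans (cong (q +_) (below-no i≮s)) (+-identityʳ q))) full

-- N < k ≤ N r₁: k = q N + s with q ≥ 1, and no column is empty or full, so σ is unconstrained.
count-middle : ∀ n₁ r₁ k → k ≤ lastPos n₁ r₁ → suc n₁ + 1 ≤ k → k ≤ suc n₁ * r₁ →
  countWord (suc r₁) (suc n₁) (bkWord (suc r₁) (suc n₁) k) ≡ suc n₁ !
count-middle n₁ r₁ k k≤last N<k k≤Nr₁ =
  trans (cong (λ z → countWord R N (bkWord R N z)) k≡qN+s)
        (Unconstrained.all-free n₁ r₁ q s s<N bound heights)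
  where
  N = suc n₁
  R = suc r₁
  q = k / N
  s = k % N
  s<N = m%n<n k N
  k≡qN+s : k ≡ q * N + s
  k≡qN+s = trans (m≡m%n+[m/n]*n k N) (+-comm s (q * N))
  bound : q * N + s ≤ lastPos n₁ r₁
  bound = subst (_≤ lastPos n₁ r₁) k≡qN+s k≤last
  q≥1 : 1 ≤ q
  q≥1 = m≥n⇒m/n>0 (≤-trans (n≤1+n N) (subst (_≤ k) (+-comm N 1) N<k))
  k≤r₁N : q * N + s ≤ r₁ * N
  k≤r₁N = subst (_≤ r₁ * N) k≡qN+s (≤-trans k≤Nr₁ (≤-reflexive (*-comm N r₁)))
  heights : ∀ (i : Fin N) → q + below s (toℕ i) ≢ 0 × q + below s (toℕ i) ≢ R
  heights i = (λ e → <-irrefl (sym (m+n≡0⇒m≡0 q e)) q≥1) ,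
              (λ e → <-irrefl refl (subst (_≤ r₁ * N) (+-comm (r₁ * N) 1)
                                     (≤-trans (full⇒beyond n₁ r₁ q s (toℕ i) e) k≤r₁N)))

count-high : ∀ n₁ r₁ → 1 ≤ r₁ → ∀ k → k ≤ lastPos n₁ r₁ → suc n₁ * r₁ + 1 ≤ k →
  countWord (suc r₁) (suc n₁) (bkWord (suc r₁) (suc n₁) k)
    ≡ (suc n₁ * suc r₁ ∸ k) ^ (k + suc n₁ ∸ suc n₁ * suc r₁) * (suc n₁ * suc r₁ ∸ k) !
count-high n₁ r₁ r₁≥1 k k≤last Nr₁<k = begin
  countWord R N (bkWord R N k)             ≡⟨ cong (λ z → countWord R N (bkWord R N z)) k≡r₁N+s₀ ⟩
  countWord R N (bkWord R N (r₁ * N + s₀)) ≡⟨ High.high-count n₁ r₁ s₀ r₁≥1 s₀<N ⟩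
  (N ∸ s₀) ^ s₀ * (N ∸ s₀) !               ≡⟨ sym (cong₂ (λ u v → u ^ v * u !) NR∸k≡N∸s₀ k+N∸NR≡s₀) ⟩
  (N * R ∸ k) ^ (k + N ∸ N * R) * (N * R ∸ k) ! ∎
  where
  open ≡-Reasoning
  N = suc n₁
  R = suc r₁
  r₁N≤k : r₁ * N ≤ k
  r₁N≤k = ≤-trans (≤-reflexive (*-comm r₁ N)) (≤-trans (m≤m+n (N * r₁) 1) Nr₁<k)
  s₀ = k ∸ r₁ * N
  k≡r₁N+s₀ : k ≡ r₁ * N + s₀
  k≡r₁N+s₀ = sym (m+[n∸m]≡n r₁N≤k)
  s₀<N : s₀ < N
  s₀<N = s≤s (subst (s₀ ≤_) (m+n∸n≡m n₁ (r₁ * N)) (∸-monoˡ-≤ (r₁ * N) k≤last))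
  NR≡r₁N+N : N * R ≡ r₁ * N + N
  NR≡r₁N+N = trans (*-suc N r₁) (trans (+-comm N (N * r₁)) (cong (_+ N) (*-comm N r₁)))
  NR∸k≡N∸s₀ : N * R ∸ k ≡ N ∸ s₀
  NR∸k≡N∸s₀ = trans (cong₂ _∸_ NR≡r₁N+N k≡r₁N+s₀) ([m+n]∸[m+o]≡n∸o (r₁ * N) N s₀)
  k+N∸NR≡s₀ : k + N ∸ N * R ≡ s₀
  k+N∸NR≡s₀ = begin
    k + N ∸ N * R                   ≡⟨ cong₂ _∸_ (cong (_+ N) k≡r₁N+s₀) NR≡r₁N+N ⟩
    r₁ * N + s₀ + N ∸ (r₁ * N + N)  ≡⟨ cong (_∸ (r₁ * N + N)) (+-assoc (r₁ * N) s₀ N) ⟩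
    r₁ * N + (s₀ + N) ∸ (r₁ * N + N) ≡⟨ [m+n]∸[m+o]≡n∸o (r₁ * N) (s₀ + N) N ⟩
    s₀ + N ∸ N                      ≡⟨ m+n∸n≡m s₀ N ⟩
    s₀                              ∎

mainTheorem1 : (r n : ℕ) → 2 ≤ r → 1 ≤ n → (k : ℕ) → k ≤ r * n ∸ 1 →
    (k ≤ n → countWord r n (bkWord r n k) ≡ (k + 1) ^ (n ∸ k) * k !)
    × (n + 1 ≤ k → k ≤ n * (r ∸ 1) → countWord r n (bkWord r n k) ≡ n !)
    × (n * (r ∸ 1) + 1 ≤ k → countWord r n (bkWord r n k)
         ≡ (n * r ∸ k) ^ (k + n ∸ n * r) * (n * r ∸ k) !)
mainTheorem1 (suc (suc r₂)) (suc n₁) (s≤s (s≤s z≤n)) (s≤s z≤n) k k≤last =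
  count-low n₁ (suc r₂) (s≤s z≤n) k ,
  count-middle n₁ (suc r₂) k k≤last ,
  count-high n₁ (suc r₂) (s≤s z≤n) k k≤last
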